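{- Let $q$ be a prime power and $y=\sum_{n=0}^\infty \mathbf{a}(n)x^n\in\mathbb{F}_q[[x]]$. Assume $\mathbf{a}$ is $q$-automatic and $N_q(\mathbf{a})=m$. Then $y$ is algebraic over $\mathbb{F}_q(x)$, $\deg(y)\leq q^m-1$, and $h(y)\leq mq^{m+1}$.
   Context: A DFAO consists of input alphabet, output alphabet, finite state set, initial state $q_0$, transition function $\delta$ (extended to words by $\delta(s,wa)=\delta(\delta(s,w),a)$) and output function $\tau$. With $\Sigma_q=\{0,\dots,q-1\}$, $\mathbf{a}$ is $q$-automatic if some DFAO over $\Sigma_q$ outputs $\mathbf{a}(n)$ on the base-$q$ expansion of $n$. A reverse-reading $q$-DFAO generates $\mathbf{a}$ if for every $n\ge0$ and every base-$q$ representation $w$ of $n$ (any number of leading zeros allowed) $\tau(\delta(q_0,w^R))=\mathbf{a}(n)$, $w^R$ the reversed word; $N_q(\mathbf{a})$ is the minimal number of states of such a DFAO. For $y$ algebraic, $\deg(y)=[\mathbb{F}_q(x)(y):\mathbb{F}_q(x)]$ and $h(y)$ is the minimal $x$-degree of a nonzero $f(x,T)\in\mathbb{F}_q[x,T]$ with $f(x,y)=0$. -}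

module Defs where

open import Level using (0ℓ)
open import Algebra.Bundles using (CommutativeRing)
open import Data.Nat using (ℕ; zero; suc; _∸_; _^_; _≤_; _<_) renaming (_+_ to _+ℕ_; _*_ to _*ℕ_)
open import Data.Nat.Primality using (Prime)
open import Data.Fin using (Fin; toℕ)
open import Data.List using (List; []; _∷_; reverse; foldl)
open import Data.Product using (Σ; ∃; ∃-syntax; _×_; _,_)
open import Relation.Nullary using (¬_)
open import Data.Unit using (⊤)
open import Relation.Binary.PropositionalEquality using (_≡_)

IsPrimePower : ℕ → Set
IsPrimePower q = ∃[ p ] ∃[ k ] (Prime p × 1 ≤ k × q ≡ p ^ k)

record FiniteField (q : ℕ) : Set₁ where
  field
    commRing : CommutativeRing 0ℓ 0ℓ
  open CommutativeRing commRing public hiding (ring)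
  field
    0≉1      : ¬ (0# ≈ 1#)
    inverse  : ∀ a → ¬ (a ≈ 0#) → ∃[ b ] (a * b ≈ 1#)
    enum     : Fin q → Carrier
    enum-inj : ∀ i j → enum i ≈ enum j → i ≡ j
    enum-sur : ∀ a → ∃[ i ] (enum i ≈ a)

record DFAO (q k : ℕ) (O : Set) : Set where
  field
    q₀ : Fin k
    δ  : Fin k → Fin q → Fin k
    τ  : Fin k → O

  δ* : Fin k → List (Fin q) → Fin k
  δ* s w = foldl δ s w

open DFAO public

value : (q : ℕ) → List (Fin q) → ℕ
value q w = foldl (λ acc d → acc *ℕ q +ℕ toℕ d) 0 w

-- w is the (canonical) base-q expansion: no leading zero digit
-- (so the expansion of 0 is the empty word)
NoLeadingZero : {q : ℕ} → List (Fin q) → Set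
NoLeadingZero []      = ⊤
NoLeadingZero (d ∷ _) = ¬ (toℕ d ≡ 0)

Automatic : (q : ℕ) {O : Set} → (ℕ → O) → Set
Automatic q {O} a =
  ∃[ k ] Σ (DFAO q k O) λ M →
    ∀ (n : ℕ) (w : List (Fin q)) → NoLeadingZero w → value q w ≡ n →
      τ M (δ* M (q₀ M) w) ≡ a n

ReverseGenerates : {q k : ℕ} {O : Set} → DFAO q k O → (ℕ → O) → Set
ReverseGenerates {q} M a =
  ∀ (n : ℕ) (w : List (Fin q)) → value q w ≡ n →
    τ M (δ* M (q₀ M) (reverse w)) ≡ a n

-- N_q(a) = m : the minimal number of states of a reverse-reading
-- q-DFAO generating a is m
MinStates : (q : ℕ) {O : Set} → (ℕ → O) → ℕ → Set
MinStates q {O} a m =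
  Σ (DFAO q m O) (λ M → ReverseGenerates M a)
  × (∀ (k : ℕ) (M : DFAO q k O) → ReverseGenerates M a → m ≤ k)

module Series {q : ℕ} (F : FiniteField q) where
  open FiniteField F

  PowerSeries : Set
  PowerSeries = ℕ → Carrier

  sumTo : ℕ → (ℕ → Carrier) → Carrier
  sumTo zero    f = 0#
  sumTo (suc n) f = sumTo n f + f n

  oneS : PowerSeries
  oneS zero    = 1#
  oneS (suc _) = 0#

  mulS : PowerSeries → PowerSeries → PowerSeries
  mulS f g n = sumTo (suc n) (λ i → f i * g (n ∸ i))

  powS : PowerSeries → ℕ → PowerSeries
  powS y zero    = oneS
  powS y (suc j) = mulS y (powS y j)

  record Poly₂ : Set where
    field
      xdeg tdeg : ℕ
      coeff     : ℕ → ℕ → Carrier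
      x-bound   : ∀ i j → xdeg < i → coeff i j ≈ 0#
      T-bound   : ∀ i j → tdeg < j → coeff i j ≈ 0#

  open Poly₂ public

  NonZero₂ : Poly₂ → Set
  NonZero₂ f = ∃[ i ] ∃[ j ] (¬ (coeff f i j ≈ 0#))

  evalAt : Poly₂ → PowerSeries → PowerSeries
  evalAt f y n =
    sumTo (suc (tdeg f)) λ j →
      sumTo (suc n) λ i → coeff f i j * powS y j (n ∸ i)

  Annihilates : Poly₂ → PowerSeries → Set
  Annihilates f y = ∀ n → evalAt f y n ≈ 0#

  Algebraic : PowerSeries → Set
  Algebraic y = Σ Poly₂ λ f → NonZero₂ f × Annihilates f y

  -- deg(y) ≤ d  (deg(y) = [F_q(x)(y) : F_q(x)] = the least T-degree of a
  -- nonzero f ∈ F_q[x,T] with f(x,y) = 0)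
  DegLe : PowerSeries → ℕ → Set
  DegLe y d = Σ Poly₂ λ f → NonZero₂ f × Annihilates f y × tdeg f ≤ d

  -- h(y) ≤ d  (h(y) = least x-degree of a nonzero f ∈ F_q[x,T] with
  -- f(x,y) = 0)
  HeightLe : PowerSeries → ℕ → Set
  HeightLe y d = Σ Poly₂ λ f → NonZero₂ f × Annihilates f y × xdeg f ≤ d

-- A reverse-reading automaton with m states splits a along the last L digits of n = K q^L + r:
-- a = Σ_t Q_{L,t}(x) b_t(x^(q^L)), with Q_{L,t} of degree < q^L and b_t the series generated from
-- state t. As a^(q^j) = a(x^(q^j)) over F_q, the m + 1 series a^(q^j), j ≤ m, are combinations
-- Σ_t P_{j,t}(x) b_t(x^(q^m)) with deg P_{j,t} < q^m, and counting coefficients yields polynomials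
-- c_j of degree ≤ m q^m, not all zero, with Σ_j c_j a^(q^j) = 0. Comparing the coefficients in one
-- residue class modulo q shortens such a relation until c_0 ≠ 0; then G(x, T) = Σ_j c_j T^(q^j - 1)
-- is nonzero and a G(x, a) = 0, so G(x, a) = 0 unless a = 0.

module Submission where

open import Algebra.Bundles using (CommutativeRing; CommutativeSemiring; CommutativeMonoid)
open import Algebra.Structures using (IsCommutativeRing)
import Algebra.Construct.Pointwise as Pointwise
import Algebra.Properties.CommutativeMonoid.Sum
open import Data.Nat as ℕ using (ℕ; zero; suc; _∸_; _<_; _≤_; _<?_; s≤s; z≤n; s<s; _!; NonZero; >-nonZero⁻¹)
  renaming (_+_ to _+ℕ_; _*_ to _*ℕ_; _^_ to _^ℕ_)
import Data.Nat.Properties as ℕ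
open import Data.Nat.DivMod using (_%_; _/_; m%n<n; m≡m%n+[m/n]*n; [m+kn]%n≡m%n; m<n⇒m%n≡m;
  +-distrib-/-∣ˡ; m*n/n≡m; m<n⇒m/n≡0; m<n*o⇒m/o<n; /-monoˡ-≤; m/n*n≡m)
open import Data.Nat.Divisibility using (_∣_; divides; n∣m*n; m∣m*n; ∣⇒≤; ∣1⇒≡1)
open import Data.Nat.Combinatorics using (_C_; nCn≡1; nCk≡n!/k![n-k]!; k![n∸k]!∣n!)
open import Data.Nat.Primality using (Prime; euclidsLemma; prime⇒nonZero; prime⇒nonTrivial)
open import Data.Nat.Induction using (<-rec)
open import Data.Nat.Solver using (module +-*-Solver)
open import Data.Fin as Fin using (Fin; toℕ; fromℕ<; inject₁; fromℕ; combine; remQuot)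
import Data.Fin.Properties as Fin
open import Data.Fin.Permutation using (permutation)
open import Data.List using (List; []; _∷_; _++_; [_]; reverse; foldl; length)
open import Data.List.Properties using (foldl-++; reverse-++; length-++)
open import Data.Vec.Functional using (removeAt)
open import Data.Product using (Σ; ∃-syntax; _,_; proj₁; proj₂)
open import Data.Sum using (_⊎_; inj₁; inj₂; [_,_]′)
open import Data.Empty using (⊥-elim)
open import Function using (id; _∘_)
open import Relation.Binary.Core using (Rel)
open import Relation.Binary.Definitions using (Decidable; tri<; tri≈; tri>)
open import Relation.Binary.PropositionalEquality as ≡ using (_≡_; _≢_)
open import Relation.Nullary using (Dec; yes; no; ¬_; ¬?)
open import Relation.Nullary.Decidable using (_×-dec_; decidable-stable)
open import Defs

module FiniteSum {c ℓ} (R : CommutativeRing c ℓ) where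

  open CommutativeRing R
  open import Relation.Binary.Reasoning.Setoid setoid
  open import Algebra.Properties.CommutativeSemigroup +-commutativeSemigroup using (interchange)
  open import Algebra.Properties.AbelianGroup +-abelianGroup using (⁻¹-∙-comm)
  open import Algebra.Properties.Group +-group using (ε⁻¹≈ε)

  𝟙 : ∀ {P : Set} → Dec P → Carrier
  𝟙 (yes _) = 1#
  𝟙 (no _)  = 0#

  𝟙-yes : ∀ {P : Set} (P? : Dec P) → P → 𝟙 P? ≈ 1#
  𝟙-yes (yes _) _ = refl
  𝟙-yes (no ¬p) p = ⊥-elim (¬p p)

  𝟙-no : ∀ {P : Set} (P? : Dec P) → ¬ P → 𝟙 P? ≈ 0#
  𝟙-no (yes p) ¬p = ⊥-elim (¬p p)
  𝟙-no (no _)  _  = refl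

  infixl 10 ∑<

  ∑< : ℕ → (ℕ → Carrier) → Carrier
  ∑< zero    f = 0#
  ∑< (suc n) f = ∑< n f + f n

  syntax ∑< n (λ i → x) = ∑[ i < n ] x

  ∑-cong< : ∀ n {f g} → (∀ i → i < n → f i ≈ g i) → ∑< n f ≈ ∑< n g
  ∑-cong< zero    f≈g = refl
  ∑-cong< (suc n) f≈g = +-cong (∑-cong< n (λ i i<n → f≈g i (ℕ.m<n⇒m<1+n i<n))) (f≈g n ℕ.≤-refl)

  ∑-cong : ∀ n {f g} → (∀ i → f i ≈ g i) → ∑< n f ≈ ∑< n g
  ∑-cong n f≈g = ∑-cong< n (λ i _ → f≈g i)

  ∑-zero : ∀ n {f} → (∀ i → i < n → f i ≈ 0#) → ∑< n f ≈ 0#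
  ∑-zero zero    f≈0 = refl
  ∑-zero (suc n) f≈0 =
    trans (+-cong (∑-zero n (λ i i<n → f≈0 i (ℕ.m<n⇒m<1+n i<n))) (f≈0 n ℕ.≤-refl)) (+-identityˡ 0#)

  ∑-distrib-+ : ∀ n f g → ∑[ i < n ] (f i + g i) ≈ ∑< n f + ∑< n g
  ∑-distrib-+ zero    f g = sym (+-identityˡ 0#)
  ∑-distrib-+ (suc n) f g = trans (+-congʳ (∑-distrib-+ n f g)) (interchange _ _ _ _)

  ∑-distrib-sub : ∀ n f g → ∑[ i < n ] (f i - g i) ≈ ∑< n f - ∑< n g
  ∑-distrib-sub n f g = trans (∑-distrib-+ n f (λ i → - g i)) (+-congˡ (neg n))
    where
    neg : ∀ n → ∑[ i < n ] (- g i) ≈ - ∑< n g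
    neg zero    = sym ε⁻¹≈ε
    neg (suc n) = trans (+-congʳ (neg n)) (⁻¹-∙-comm _ _)

  *-distribˡ-∑ : ∀ n x f → x * ∑< n f ≈ ∑[ i < n ] (x * f i)
  *-distribˡ-∑ zero    x f = zeroʳ x
  *-distribˡ-∑ (suc n) x f = trans (distribˡ x _ _) (+-congʳ (*-distribˡ-∑ n x f))

  *-distribʳ-∑ : ∀ n x f → ∑< n f * x ≈ ∑[ i < n ] (f i * x)
  *-distribʳ-∑ n x f = trans (*-comm _ x) (trans (*-distribˡ-∑ n x f) (∑-cong n (λ i → *-comm x (f i))))

  ∑-head : ∀ n f → ∑< (suc n) f ≈ f 0 + ∑[ i < n ] f (suc i)
  ∑-head zero    f = trans (+-identityˡ _) (sym (+-identityʳ _))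
  ∑-head (suc n) f = trans (+-congʳ (∑-head n f)) (+-assoc _ _ _)

  ∑-split : ∀ m n f → ∑< (m +ℕ n) f ≈ ∑< m f + ∑[ i < n ] f (m +ℕ i)
  ∑-split m zero    f rewrite ℕ.+-identityʳ m = sym (+-identityʳ _)
  ∑-split m (suc n) f rewrite ℕ.+-suc m n = trans (+-congʳ (∑-split m n f)) (+-assoc _ _ _)

  ∑-blocks : ∀ k r f → ∑< (k *ℕ r) f ≈ ∑[ a < k ] ∑[ s < r ] f (a *ℕ r +ℕ s)
  ∑-blocks zero    r f = refl
  ∑-blocks (suc k) r f = begin
    ∑< (r +ℕ k *ℕ r) f                           ≡⟨ ≡.cong (λ n → ∑< n f) (ℕ.+-comm r (k *ℕ r)) ⟩
    ∑< (k *ℕ r +ℕ r) f                           ≈⟨ ∑-split (k *ℕ r) r f ⟩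
    ∑< (k *ℕ r) f + ∑[ s < r ] f (k *ℕ r +ℕ s)   ≈⟨ +-congʳ (∑-blocks k r f) ⟩
    ∑[ a < suc k ] ∑[ s < r ] f (a *ℕ r +ℕ s)   ∎

  ∑-comm : ∀ m n (f : ℕ → ℕ → Carrier) → ∑[ i < m ] ∑[ j < n ] f i j ≈ ∑[ j < n ] ∑[ i < m ] f i j
  ∑-comm zero    n f = sym (∑-zero n (λ _ _ → refl))
  ∑-comm (suc m) n f =
    trans (+-congʳ (∑-comm m n f)) (sym (∑-distrib-+ n (λ j → ∑[ i < m ] f i j) (λ j → f m j)))

  ∑-reverse : ∀ n f → ∑< n f ≈ ∑[ i < n ] f (n ∸ suc i)
  ∑-reverse zero    f = refl
  ∑-reverse (suc n) f = begin
    ∑< n f + f n                                ≈⟨ +-comm _ _ ⟩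
    f n + ∑< n f                                ≈⟨ +-congˡ (∑-reverse n f) ⟩
    f n + ∑[ i < n ] f (n ∸ suc i)              ≈⟨ ∑-head n (λ i → f (suc n ∸ suc i)) ⟨
    ∑[ i < suc n ] f (suc n ∸ suc i)            ∎

  ∑-single : ∀ n k f → k < n → (∀ i → i < n → i ≢ k → f i ≈ 0#) → ∑< n f ≈ f k
  ∑-single (suc n) k f k<1+n others with n ℕ.≟ k
  ... | yes ≡.refl = trans (+-congʳ (∑-zero n (λ i i<n → others i (ℕ.m<n⇒m<1+n i<n) (ℕ.<⇒≢ i<n))))
                           (+-identityˡ _)
  ... | no n≢k = trans (+-cong (∑-single n k f k<n (λ i i<n → others i (ℕ.m<n⇒m<1+n i<n)))
                               (others n ℕ.≤-refl n≢k))
                       (+-identityʳ _)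
    where k<n = ℕ.≤∧≢⇒< (ℕ.≤-pred k<1+n) (λ k≡n → n≢k (≡.sym k≡n))

  ∑-triangle : ∀ n (f : ℕ → ℕ → Carrier) →
    ∑[ a < suc n ] ∑[ i < suc a ] f i (a ∸ i) ≈ ∑[ i < suc n ] ∑[ b < suc (n ∸ i) ] f i b
  ∑-triangle zero    f = refl
  ∑-triangle (suc n) f = begin
    ∑[ a < suc n ] ∑[ i < suc a ] f i (a ∸ i) + ∑[ i < suc (suc n) ] f i (suc n ∸ i)
      ≈⟨ +-cong (∑-triangle n f) (+-congˡ (sym (+-identityˡ _))) ⟩
    ∑[ i < suc n ] ∑[ b < suc (n ∸ i) ] f i b + (∑[ i < suc n ] f i (suc n ∸ i) + (0# + f (suc n) (n ∸ n)))
      ≈⟨ sym (+-assoc _ _ _) ⟩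
    ∑[ i < suc n ] ∑[ b < suc (n ∸ i) ] f i b + ∑[ i < suc n ] f i (suc n ∸ i) + (0# + f (suc n) (n ∸ n))
      ≈⟨ +-congʳ (sym (∑-distrib-+ (suc n) _ _)) ⟩
    ∑[ i < suc n ] (∑[ b < suc (n ∸ i) ] f i b + f i (suc n ∸ i)) + (0# + f (suc n) (n ∸ n))
      ≈⟨ +-cong (∑-cong< (suc n) (λ i i≤n → row i (ℕ.≤-pred i≤n))) corner ⟩
    ∑[ i < suc (suc n) ] ∑[ b < suc (suc n ∸ i) ] f i b
      ∎
    where
    row : ∀ i → i ≤ n → ∑[ b < suc (n ∸ i) ] f i b + f i (suc n ∸ i) ≈ ∑[ b < suc (suc n ∸ i) ] f i b
    row i i≤n rewrite ℕ.+-∸-assoc 1 i≤n = refl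
    corner : 0# + f (suc n) (n ∸ n) ≈ ∑[ b < suc (n ∸ n) ] f (suc n) b
    corner rewrite ℕ.n∸n≡0 n = refl

module PowerSeriesRing {c ℓ} (R : CommutativeRing c ℓ) where

  open CommutativeRing R hiding (isCommutativeRing; zero)
  open FiniteSum R
  open import Relation.Binary.Reasoning.Setoid setoid

  PowerSeries : Set c
  PowerSeries = ℕ → Carrier

  infix  4 _≈ₛ_
  infixl 7 _*ₛ_
  infixl 6 _+ₛ_ _-ₛ_
  infix  8 -ₛ_

  _≈ₛ_ : Rel PowerSeries ℓ
  f ≈ₛ g = ∀ n → f n ≈ g n

  _+ₛ_ : PowerSeries → PowerSeries → PowerSeries
  (f +ₛ g) n = f n + g n

  -ₛ_ : PowerSeries → PowerSeries
  (-ₛ f) n = - f n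

  _-ₛ_ : PowerSeries → PowerSeries → PowerSeries
  f -ₛ g = f +ₛ -ₛ g

  _*ₛ_ : PowerSeries → PowerSeries → PowerSeries
  (f *ₛ g) n = ∑[ i < suc n ] (f i * g (n ∸ i))

  0ₛ : PowerSeries
  0ₛ _ = 0#

  C : Carrier → PowerSeries
  C a zero    = a
  C a (suc _) = 0#

  1ₛ : PowerSeries
  1ₛ = C 1#

  X : PowerSeries
  X (suc zero) = 1#
  X _          = 0#

  *ₛ-cong : ∀ {f f′ g g′} → f ≈ₛ f′ → g ≈ₛ g′ → f *ₛ g ≈ₛ f′ *ₛ g′
  *ₛ-cong f≈f′ g≈g′ n = ∑-cong (suc n) (λ i → *-cong (f≈f′ i) (g≈g′ (n ∸ i)))

  *ₛ-coeff-lowest : ∀ f g k n → (∀ i → i < k → f i ≈ 0#) → (∀ j → j < n → g j ≈ 0#) →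
                    (f *ₛ g) (k +ℕ n) ≈ f k * g n
  *ₛ-coeff-lowest f g k n f<k≈0 g<n≈0 =
    trans (∑-single (suc (k +ℕ n)) k _ (s≤s (ℕ.m≤m+n k n)) others)
          (*-congˡ (reflexive (≡.cong g (ℕ.m+n∸m≡n k n))))
    where
    others : ∀ i → i < suc (k +ℕ n) → i ≢ k → f i * g (k +ℕ n ∸ i) ≈ 0#
    others i i≤k+n i≢k with ℕ.<-cmp i k
    ... | tri< i<k _ _ = trans (*-congʳ (f<k≈0 i i<k)) (zeroˡ _)
    ... | tri≈ _ i≡k _ = ⊥-elim (i≢k i≡k)
    ... | tri> _ _ k<i = trans (*-congˡ (g<n≈0 _ k+n∸i<n)) (zeroʳ _)
      where
      k+n∸i<n : k +ℕ n ∸ i < n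
      k+n∸i<n = ℕ.<-≤-trans (ℕ.∸-monoʳ-< k<i (ℕ.≤-pred i≤k+n)) (ℕ.≤-reflexive (ℕ.m+n∸m≡n k n))

  C-cong : ∀ {a b} → a ≈ b → C a ≈ₛ C b
  C-cong a≈b zero    = a≈b
  C-cong a≈b (suc _) = refl

  C-0≈0ₛ : C 0# ≈ₛ 0ₛ
  C-0≈0ₛ zero    = refl
  C-0≈0ₛ (suc _) = refl

  *ₛ-vanish-below : ∀ f g n → (∀ i → i < n → f i ≈ 0#) → ∀ i → i < n → (f *ₛ g) i ≈ 0#
  *ₛ-vanish-below f g n f<n≈0 i i<n =
    ∑-zero (suc i) (λ l l≤i → trans (*-congʳ (f<n≈0 l (ℕ.<-≤-trans l≤i i<n))) (zeroˡ _))

  *ₛ-coeff-constant : ∀ f g n → (∀ i → 0 < i → f i ≈ 0#) → (f *ₛ g) n ≈ f 0 * g n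
  *ₛ-coeff-constant f g n f>0≈0 = ∑-single (suc n) 0 _ (s≤s z≤n) λ where
    zero    _ 0≢0 → ⊥-elim (0≢0 ≡.refl)
    (suc i) _ _   → trans (*-congʳ (f>0≈0 (suc i) (s≤s z≤n))) (zeroˡ _)

  *ₛ-degree : ∀ f g d e → (∀ i → d < i → f i ≈ 0#) → (∀ i → e ≤ i → g i ≈ 0#) →
              ∀ n → d +ℕ e ≤ n → (f *ₛ g) n ≈ 0#
  *ₛ-degree f g d e f>d≈0 g≥e≈0 n d+e≤n = ∑-zero (suc n) term
    where
    term : ∀ i → i < suc n → f i * g (n ∸ i) ≈ 0#
    term i _ with d ℕ.<? i
    ... | yes d<i = trans (*-congʳ (f>d≈0 i d<i)) (zeroˡ _)
    ... | no  d≮i = trans (*-congˡ (g≥e≈0 (n ∸ i) e≤n∸i)) (zeroʳ _)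
      where
      e≤n∸i : e ≤ n ∸ i
      e≤n∸i = ℕ.≤-trans (ℕ.≤-reflexive (≡.sym (ℕ.m+n∸m≡n d e)))
                        (ℕ.≤-trans (ℕ.∸-monoˡ-≤ d d+e≤n) (ℕ.∸-monoʳ-≤ n (ℕ.≮⇒≥ d≮i)))

  C-*ₛ : ∀ a g n → (C a *ₛ g) n ≈ a * g n
  C-*ₛ a g n = *ₛ-coeff-constant (C a) g n λ where (suc _) _ → refl

  *ₛ-identityˡ : ∀ f → 1ₛ *ₛ f ≈ₛ f
  *ₛ-identityˡ f n = trans (C-*ₛ 1# f n) (*-identityˡ (f n))

  X-*ₛ-zero : ∀ g → (X *ₛ g) 0 ≈ 0#
  X-*ₛ-zero g = trans (+-identityˡ _) (zeroˡ _)

  X-*ₛ-suc : ∀ g n → (X *ₛ g) (suc n) ≈ g n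
  X-*ₛ-suc g n = trans (∑-single (suc (suc n)) 1 _ (s≤s (s≤s z≤n)) others) (*-identityˡ (g n))
    where
    others : ∀ i → i < suc (suc n) → i ≢ 1 → X i * g (suc n ∸ i) ≈ 0#
    others zero          _ _   = zeroˡ _
    others (suc zero)    _ 1≢1 = ⊥-elim (1≢1 ≡.refl)
    others (suc (suc i)) _ _   = zeroˡ _

  *ₛ-comm : ∀ f g → f *ₛ g ≈ₛ g *ₛ f
  *ₛ-comm f g n = begin
    ∑[ i < suc n ] (f i * g (n ∸ i))              ≈⟨ ∑-reverse (suc n) _ ⟩
    ∑[ i < suc n ] (f (n ∸ i) * g (n ∸ (n ∸ i)))  ≈⟨ ∑-cong< (suc n) (λ i i≤n → swap i (ℕ.≤-pred i≤n)) ⟩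
    ∑[ i < suc n ] (g i * f (n ∸ i))              ∎
    where
    swap : ∀ i → i ≤ n → f (n ∸ i) * g (n ∸ (n ∸ i)) ≈ g i * f (n ∸ i)
    swap i i≤n = trans (*-comm _ _) (*-congʳ (reflexive (≡.cong g (ℕ.m∸[m∸n]≡n i≤n))))

  *ₛ-assoc : ∀ f g h → (f *ₛ g) *ₛ h ≈ₛ f *ₛ (g *ₛ h)
  *ₛ-assoc f g h n = begin
    ∑[ a < suc n ] ((f *ₛ g) a * h (n ∸ a))
      ≈⟨ ∑-cong (suc n) expand ⟩
    ∑[ a < suc n ] ∑[ i < suc a ] φ i (a ∸ i)
      ≈⟨ ∑-triangle n φ ⟩
    ∑[ i < suc n ] ∑[ b < suc (n ∸ i) ] φ i b
      ≈⟨ ∑-cong (suc n) collect ⟩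
    ∑[ i < suc n ] (f i * (g *ₛ h) (n ∸ i))
      ∎
    where
    φ : ℕ → ℕ → Carrier
    φ i b = f i * (g b * h (n ∸ (i +ℕ b)))
    expand : ∀ a → (f *ₛ g) a * h (n ∸ a) ≈ ∑[ i < suc a ] φ i (a ∸ i)
    expand a = trans (*-distribʳ-∑ (suc a) _ _) (∑-cong< (suc a) λ i i≤a →
      trans (*-assoc _ _ _) (*-congˡ (*-congˡ (reflexive (≡.cong (λ k → h (n ∸ k)) (≡.sym (ℕ.m+[n∸m]≡n (ℕ.≤-pred i≤a))))))))
    collect : ∀ i → ∑[ b < suc (n ∸ i) ] φ i b ≈ f i * (g *ₛ h) (n ∸ i)
    collect i = trans (∑-cong (suc (n ∸ i)) λ b → *-congˡ (*-congˡ (reflexive (≡.cong h (≡.sym (ℕ.∸-+-assoc n i b))))))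
                      (sym (*-distribˡ-∑ (suc (n ∸ i)) _ _))

  *ₛ-distribˡ : ∀ f g h → f *ₛ (g +ₛ h) ≈ₛ f *ₛ g +ₛ f *ₛ h
  *ₛ-distribˡ f g h n = trans (∑-cong (suc n) (λ i → distribˡ (f i) _ _)) (∑-distrib-+ (suc n) _ _)

  *ₛ-distribʳ : ∀ f g h → (g +ₛ h) *ₛ f ≈ₛ g *ₛ f +ₛ h *ₛ f
  *ₛ-distribʳ f g h n = trans (∑-cong (suc n) (λ i → distribʳ (f (n ∸ i)) _ _)) (∑-distrib-+ (suc n) _ _)

  isCommutativeRing : IsCommutativeRing _≈ₛ_ _+ₛ_ _*ₛ_ -ₛ_ 0ₛ 1ₛ
  isCommutativeRing = record
    { isRing = record
      { +-isAbelianGroup = Pointwise.isAbelianGroup ℕ +-isAbelianGroup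
      ; *-cong           = *ₛ-cong
      ; *-assoc          = *ₛ-assoc
      ; *-identity       = *ₛ-identityˡ , λ f n → trans (*ₛ-comm f 1ₛ n) (*ₛ-identityˡ f n)
      ; distrib          = *ₛ-distribˡ , *ₛ-distribʳ
      }
    ; *-comm = *ₛ-comm
    }

  R⟦x⟧ : CommutativeRing c ℓ
  R⟦x⟧ = record { isCommutativeRing = isCommutativeRing }

  open import Algebra.Properties.Semiring.Exp (CommutativeRing.semiring R⟦x⟧) public
    using () renaming (_^_ to _^ₛ_)

  infixl 10 ∑ₛ<

  ∑ₛ< : ℕ → (ℕ → PowerSeries) → PowerSeries
  ∑ₛ< = FiniteSum.∑< R⟦x⟧

  syntax ∑ₛ< n (λ i → x) = ∑ₛ[ i < n ] x

  ∑ₛ-coeff : ∀ n (F : ℕ → PowerSeries) k → (∑ₛ[ t < n ] F t) k ≈ ∑[ t < n ] F t k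
  ∑ₛ-coeff zero    F k = refl
  ∑ₛ-coeff (suc n) F k = +-congʳ (∑ₛ-coeff n F k)

  open import Algebra.Properties.Semiring.Exp semiring using (_^_)
  open import Algebra.Properties.Semiring.Mult semiring using (_×_)
  open import Algebra.Properties.Semiring.Mult (CommutativeRing.semiring R⟦x⟧) public using () renaming (_×_ to _×ₛ_)

  tail : PowerSeries → PowerSeries
  tail z i = z (suc i)

  C+X*tail : ∀ z → z ≈ₛ C (z 0) +ₛ X *ₛ tail z
  C+X*tail z zero    = sym (trans (+-congˡ (X-*ₛ-zero (tail z))) (+-identityʳ _))
  C+X*tail z (suc n) = sym (trans (+-congˡ (X-*ₛ-suc (tail z) n)) (+-identityˡ _))

  C-^ₛ : ∀ a n → C a ^ₛ n ≈ₛ C (a ^ n)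
  C-^ₛ a zero    i       = refl
  C-^ₛ a (suc n) i       = trans (C-*ₛ a (C a ^ₛ n) i) (trans (*-congˡ (C-^ₛ a n i)) (scale i))
    where
    scale : ∀ i → a * C (a ^ n) i ≈ C (a * a ^ n) i
    scale zero    = refl
    scale (suc _) = zeroʳ a

  ×ₛ1ₛ≈C : ∀ n → n ×ₛ 1ₛ ≈ₛ C (n × 1#)
  ×ₛ1ₛ≈C zero    zero    = refl
  ×ₛ1ₛ≈C zero    (suc i) = refl
  ×ₛ1ₛ≈C (suc n) zero    = +-congˡ (×ₛ1ₛ≈C n zero)
  ×ₛ1ₛ≈C (suc n) (suc i) = trans (+-congˡ (×ₛ1ₛ≈C n (suc i))) (+-identityˡ 0#)

  X^r*ₛ-coeff-shift : ∀ r w m → (X ^ₛ r *ₛ w) (r +ℕ m) ≈ w m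
  X^r*ₛ-coeff-shift zero    w m = *ₛ-identityˡ w m
  X^r*ₛ-coeff-shift (suc r) w m =
    trans (*ₛ-assoc X (X ^ₛ r) w (suc r +ℕ m)) (trans (X-*ₛ-suc (X ^ₛ r *ₛ w) (r +ℕ m)) (X^r*ₛ-coeff-shift r w m))

  X^r*ₛ-coeff-low : ∀ r w n → n < r → (X ^ₛ r *ₛ w) n ≈ 0#
  X^r*ₛ-coeff-low (suc r) w zero    _         = trans (*ₛ-assoc X (X ^ₛ r) w 0) (X-*ₛ-zero (X ^ₛ r *ₛ w))
  X^r*ₛ-coeff-low (suc r) w (suc n) (s≤s n<r) =
    trans (*ₛ-assoc X (X ^ₛ r) w (suc n)) (trans (X-*ₛ-suc (X ^ₛ r *ₛ w) n) (X^r*ₛ-coeff-low r w n n<r))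

module _ {r : ℕ} .{{_ : NonZero r}} where

  [Kr+s]%r≡s : ∀ K {s} → s < r → (K *ℕ r +ℕ s) % r ≡ s
  [Kr+s]%r≡s K {s} s<r =
    ≡.trans (≡.cong (_% r) (ℕ.+-comm (K *ℕ r) s)) (≡.trans ([m+kn]%n≡m%n s K r) (m<n⇒m%n≡m s<r))

  [Kr+s]/r≡K : ∀ K {s} → s < r → (K *ℕ r +ℕ s) / r ≡ K
  [Kr+s]/r≡K K {s} s<r = ≡.trans (+-distrib-/-∣ˡ s (n∣m*n K))
    (≡.trans (≡.cong₂ _+ℕ_ (m*n/n≡m K r) (m<n⇒m/n≡0 s<r)) (ℕ.+-identityʳ K))

  n≡[n/r]*r+n%r : ∀ n → n ≡ n / r *ℕ r +ℕ n % r
  n≡[n/r]*r+n%r n = ≡.trans (m≡m%n+[m/n]*n n r) (ℕ.+-comm (n % r) _)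

[Kr+s]∸ar≡[K∸a]r+s : ∀ K r s a → a ≤ K → K *ℕ r +ℕ s ∸ a *ℕ r ≡ (K ∸ a) *ℕ r +ℕ s
[Kr+s]∸ar≡[K∸a]r+s K r s a a≤K = begin
  K *ℕ r +ℕ s ∸ a *ℕ r    ≡⟨ ℕ.+-∸-comm s (ℕ.*-monoˡ-≤ r a≤K) ⟩
  K *ℕ r ∸ a *ℕ r +ℕ s    ≡⟨ ≡.cong (_+ℕ s) (ℕ.*-distribʳ-∸ r K a) ⟨
  (K ∸ a) *ℕ r +ℕ s       ∎
  where open ≡.≡-Reasoning

module Inflation {c ℓ} (R : CommutativeRing c ℓ) where

  open CommutativeRing R hiding (isCommutativeRing)
  open FiniteSum R
  open PowerSeriesRing R
  open import Relation.Binary.Reasoning.Setoid setoid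

  -- the coefficient of x^(K r + s) in z(x^r), for s < r
  residueCoeff : ℕ → ℕ → PowerSeries → Carrier
  residueCoeff zero    K z = z K
  residueCoeff (suc _) K z = 0#

  residueCoeff-pos : ∀ {s} K z → 0 < s → residueCoeff s K z ≡ 0#
  residueCoeff-pos {suc _} K z _ = ≡.refl

  _∘x^_ : PowerSeries → (r : ℕ) .{{_ : NonZero r}} → PowerSeries
  (z ∘x^ r) n = residueCoeff (n % r) (n / r) z

  section : ℕ → ℕ → PowerSeries → PowerSeries
  section r s A i = A (i *ℕ r +ℕ s)

  module _ {r : ℕ} .{{_ : NonZero r}} where

    ≈ₛ-by-residues : ∀ {f g} → (∀ K s → s < r → f (K *ℕ r +ℕ s) ≈ g (K *ℕ r +ℕ s)) → f ≈ₛ g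
    ≈ₛ-by-residues {f} {g} cell n = begin
      f n                         ≡⟨ ≡.cong f (n≡[n/r]*r+n%r n) ⟩
      f (n / r *ℕ r +ℕ n % r)     ≈⟨ cell (n / r) (n % r) (m%n<n n r) ⟩
      g (n / r *ℕ r +ℕ n % r)     ≡⟨ ≡.cong g (n≡[n/r]*r+n%r n) ⟨
      g n                         ∎

    ∘x^-coeff : ∀ z K {s} → s < r → (z ∘x^ r) (K *ℕ r +ℕ s) ≡ residueCoeff s K z
    ∘x^-coeff z K s<r = ≡.cong₂ (λ s K → residueCoeff s K z) ([Kr+s]%r≡s K s<r) ([Kr+s]/r≡K K s<r)

    ∘x^-coeff-multiple : ∀ z K → (z ∘x^ r) (K *ℕ r) ≈ z K
    ∘x^-coeff-multiple z K = reflexive (≡.trans (≡.cong (z ∘x^ r) (≡.sym (ℕ.+-identityʳ (K *ℕ r))))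
                                                (∘x^-coeff z K (>-nonZero⁻¹ r)))

    ∘x^-coeff-offgrid : ∀ z K {s} → 0 < s → s < r → (z ∘x^ r) (K *ℕ r +ℕ s) ≈ 0#
    ∘x^-coeff-offgrid z K 0<s s<r = reflexive (≡.trans (∘x^-coeff z K s<r) (residueCoeff-pos K z 0<s))

    ∘x^-degree : ∀ z B → (∀ i → B ≤ i → z i ≈ 0#) → ∀ n → B *ℕ r ≤ n → (z ∘x^ r) n ≈ 0#
    ∘x^-degree z B z≥B≈0 n Br≤n = vanish (n % r)
      where
      vanish : ∀ s → residueCoeff s (n / r) z ≈ 0#
      vanish zero    = z≥B≈0 (n / r) (≡.subst (_≤ n / r) (m*n/n≡m B r) (/-monoˡ-≤ r Br≤n))
      vanish (suc _) = refl

    ∘x^-cong : ∀ {z z′} → z ≈ₛ z′ → z ∘x^ r ≈ₛ z′ ∘x^ r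
    ∘x^-cong {z} {z′} z≈z′ n = cong-residue (n % r)
      where
      cong-residue : ∀ s → residueCoeff s (n / r) z ≈ residueCoeff s (n / r) z′
      cong-residue zero    = z≈z′ (n / r)
      cong-residue (suc _) = refl

    ∘x^-+ₛ : ∀ z z′ → (z +ₛ z′) ∘x^ r ≈ₛ z ∘x^ r +ₛ z′ ∘x^ r
    ∘x^-+ₛ z z′ n = +-residue (n % r)
      where
      +-residue : ∀ s → residueCoeff s (n / r) (z +ₛ z′) ≈ residueCoeff s (n / r) z + residueCoeff s (n / r) z′
      +-residue zero    = refl
      +-residue (suc _) = sym (+-identityʳ 0#)

    ∘x^-0ₛ : 0ₛ ∘x^ r ≈ₛ 0ₛ
    ∘x^-0ₛ n = 0-residue (n % r)
      where
      0-residue : ∀ s → residueCoeff s (n / r) 0ₛ ≈ 0#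
      0-residue zero    = refl
      0-residue (suc _) = refl

    ∘x^-∑ₛ : ∀ n (F : ℕ → PowerSeries) → (∑ₛ[ t < n ] F t) ∘x^ r ≈ₛ ∑ₛ[ t < n ] (F t ∘x^ r)
    ∘x^-∑ₛ zero    F k = ∘x^-0ₛ k
    ∘x^-∑ₛ (suc n) F k = trans (∘x^-+ₛ (∑ₛ< n F) (F n) k) (+-congʳ (∘x^-∑ₛ n F k))

    -- Only the coefficients of B(x^r) at multiples of r contribute.
    *ₛ-∘x^-coeff : ∀ A B K {s} → s < r → (A *ₛ (B ∘x^ r)) (K *ℕ r +ℕ s) ≈ (section r s A *ₛ B) K
    *ₛ-∘x^-coeff A B K {s} s<r = begin
      (A *ₛ (B ∘x^ r)) n
        ≈⟨ *ₛ-comm A (B ∘x^ r) n ⟩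
      ∑< (suc n) g
        ≡⟨ ≡.cong (λ k → ∑< k g) (ℕ.+-suc (K *ℕ r) s) ⟨
      ∑< (K *ℕ r +ℕ suc s) g
        ≈⟨ ∑-split (K *ℕ r) (suc s) g ⟩
      ∑< (K *ℕ r) g + ∑[ u < suc s ] g (K *ℕ r +ℕ u)
        ≈⟨ +-cong (∑-blocks K r g) (onGrid K (suc s) (s≤s z≤n) (λ u u≤s → ℕ.≤-<-trans (ℕ.≤-pred u≤s) s<r)) ⟩
      ∑[ a < K ] ∑[ u < r ] g (a *ℕ r +ℕ u) + g (K *ℕ r +ℕ 0)
        ≈⟨ +-congʳ (∑-cong< K (λ a _ → onGrid a r (>-nonZero⁻¹ r) (λ u u<r → u<r))) ⟩
      ∑[ a < suc K ] g (a *ℕ r +ℕ 0)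
        ≈⟨ ∑-cong< (suc K) (λ a a≤K → term a (ℕ.≤-pred a≤K)) ⟩
      (B *ₛ section r s A) K
        ≈⟨ *ₛ-comm B (section r s A) K ⟩
      (section r s A *ₛ B) K
        ∎
      where
      n = K *ℕ r +ℕ s
      g : ℕ → Carrier
      g j = (B ∘x^ r) j * A (n ∸ j)
      onGrid : ∀ a w → 0 < w → (∀ u → u < w → u < r) → ∑[ u < w ] g (a *ℕ r +ℕ u) ≈ g (a *ℕ r +ℕ 0)
      onGrid a w 0<w w≤r = ∑-single w 0 _ 0<w λ where
        zero    _   0≢0 → ⊥-elim (0≢0 ≡.refl)
        (suc u) u<w _   → trans (*-congʳ (∘x^-coeff-offgrid B a (s≤s z≤n) (w≤r (suc u) u<w))) (zeroˡ _)
      term : ∀ a → a ≤ K → g (a *ℕ r +ℕ 0) ≈ B a * section r s A (K ∸ a)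
      term a a≤K = *-cong (reflexive (∘x^-coeff B a (>-nonZero⁻¹ r)))
        (reflexive (≡.cong A (≡.trans (≡.cong (n ∸_) (ℕ.+-identityʳ (a *ℕ r))) ([Kr+s]∸ar≡[K∸a]r+s K r s a a≤K))))

    ∘x^-*ₛ : ∀ A B → (A *ₛ B) ∘x^ r ≈ₛ (A ∘x^ r) *ₛ (B ∘x^ r)
    ∘x^-*ₛ A B = ≈ₛ-by-residues λ K s s<r → begin
      ((A *ₛ B) ∘x^ r) (K *ℕ r +ℕ s)          ≡⟨ ∘x^-coeff (A *ₛ B) K s<r ⟩
      residueCoeff s K (A *ₛ B)               ≈⟨ residue s K ⟩
      ((λ i → residueCoeff s i A) *ₛ B) K     ≈⟨ *ₛ-cong {g = B} (λ i → reflexive (∘x^-coeff A i s<r)) (λ _ → refl) K ⟨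
      (section r s (A ∘x^ r) *ₛ B) K          ≈⟨ *ₛ-∘x^-coeff (A ∘x^ r) B K s<r ⟨
      ((A ∘x^ r) *ₛ (B ∘x^ r)) (K *ℕ r +ℕ s)  ∎
      where
      residue : ∀ s K → residueCoeff s K (A *ₛ B) ≈ ((λ i → residueCoeff s i A) *ₛ B) K
      residue zero    K = refl
      residue (suc _) K = sym (CommutativeRing.zeroˡ R⟦x⟧ B K)

  ∘x^-≡ : ∀ {r r′} .{{_ : NonZero r}} .{{_ : NonZero r′}} → r ≡ r′ → ∀ z → z ∘x^ r ≈ₛ z ∘x^ r′
  ∘x^-≡ ≡.refl z n = refl

  ∘x^-∘x^ : ∀ t r .{{_ : NonZero t}} .{{_ : NonZero r}} .{{_ : NonZero (t *ℕ r)}} z →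
            (z ∘x^ t) ∘x^ r ≈ₛ z ∘x^ (t *ℕ r)
  ∘x^-∘x^ t r z = ≈ₛ-by-residues {t *ℕ r} λ K s₂ s₂<tr → begin
    ((z ∘x^ t) ∘x^ r) (K *ℕ (t *ℕ r) +ℕ s₂)                ≡⟨ ≡.cong ((z ∘x^ t) ∘x^ r) (digits K s₂) ⟩
    ((z ∘x^ t) ∘x^ r) ((K *ℕ t +ℕ s₂ / r) *ℕ r +ℕ s₂ % r)  ≡⟨ ∘x^-coeff (z ∘x^ t) (K *ℕ t +ℕ s₂ / r) (m%n<n s₂ r) ⟩
    residueCoeff (s₂ % r) (K *ℕ t +ℕ s₂ / r) (z ∘x^ t)      ≡⟨ residue K (s₂ % r) (s₂ / r) (m<n*o⇒m/o<n s₂<tr) ⟩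
    residueCoeff (s₂ / r *ℕ r +ℕ s₂ % r) K z               ≡⟨ ≡.cong (λ s → residueCoeff s K z) (n≡[n/r]*r+n%r s₂) ⟨
    residueCoeff s₂ K z                                    ≡⟨ ∘x^-coeff z K s₂<tr ⟨
    (z ∘x^ (t *ℕ r)) (K *ℕ (t *ℕ r) +ℕ s₂)                 ∎
    where
    open +-*-Solver
    digits : ∀ K s₂ → K *ℕ (t *ℕ r) +ℕ s₂ ≡ (K *ℕ t +ℕ s₂ / r) *ℕ r +ℕ s₂ % r
    digits K s₂ = ≡.trans (≡.cong (K *ℕ (t *ℕ r) +ℕ_) (n≡[n/r]*r+n%r s₂))
      (solve 5 (λ K t r a b → K :* (t :* r) :+ (a :* r :+ b) := (K :* t :+ a) :* r :+ b) ≡.refl K t r (s₂ / r) (s₂ % r))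
    residue : ∀ K s s′ → s′ < t → residueCoeff s (K *ℕ t +ℕ s′) (z ∘x^ t) ≡ residueCoeff (s′ *ℕ r +ℕ s) K z
    residue K (suc s) s′ _    = ≡.sym (residueCoeff-pos K z (ℕ.<-≤-trans (s≤s z≤n) (ℕ.m≤n+m (suc s) (s′ *ℕ r))))
    residue K zero    s′ s′<t = ≡.trans (∘x^-coeff z K s′<t) (onGrid s′)
      where
      onGrid : ∀ s′ → residueCoeff s′ K z ≡ residueCoeff (s′ *ℕ r +ℕ 0) K z
      onGrid zero     = ≡.refl
      onGrid (suc s′) = ≡.sym (residueCoeff-pos K z
        (ℕ.<-≤-trans (>-nonZero⁻¹ r) (ℕ.≤-trans (ℕ.m≤m+n r (s′ *ℕ r)) (ℕ.m≤m+n _ 0))))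

module InflationByPowers {c ℓ} (R : CommutativeRing c ℓ) (q : ℕ) .{{_ : NonZero q}} where

  open CommutativeRing R using (refl)
  open PowerSeriesRing R
  open Inflation R
  private module R⟦x⟧ = CommutativeRing R⟦x⟧

  _∘x^q^_ : PowerSeries → ℕ → PowerSeries
  z ∘x^q^ j = (z ∘x^ (q ^ℕ j)) {{ℕ.m^n≢0 q j}}

  ∘x^q^-∘x^q^ : ∀ i j z → (z ∘x^q^ i) ∘x^q^ j ≈ₛ z ∘x^q^ (i +ℕ j)
  ∘x^q^-∘x^q^ i j z = R⟦x⟧.trans (∘x^-∘x^ (q ^ℕ i) (q ^ℕ j) z) (∘x^-≡ (≡.sym (ℕ.^-distribˡ-+-* q i j)) z)
    where
    instance
      qⁱ≢0   = ℕ.m^n≢0 q i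
      qʲ≢0   = ℕ.m^n≢0 q j
      qⁱqʲ≢0 = ℕ.m*n≢0 (q ^ℕ i) (q ^ℕ j)
      qⁱ⁺ʲ≢0 = ℕ.m^n≢0 q (i +ℕ j)

  ∘x^q^-suc : ∀ j z → z ∘x^q^ suc j ≈ₛ (z ∘x^q^ j) ∘x^ q
  ∘x^q^-suc j z = R⟦x⟧.trans (∘x^-≡ (≡.cong (q ^ℕ_) (ℕ.+-comm 1 j)) z)
                  (R⟦x⟧.trans (R⟦x⟧.sym (∘x^q^-∘x^q^ j 1 z)) (∘x^-≡ (ℕ.*-identityʳ q) (z ∘x^q^ j)))
    where
    instance
      q¹⁺ʲ≢0 = ℕ.m^n≢0 q (suc j)
      qʲ⁺¹≢0 = ℕ.m^n≢0 q (j +ℕ 1)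
      q¹≢0   = ℕ.m^n≢0 q 1

module _ {m ℓm} (M : CommutativeMonoid m ℓm) where

  open CommutativeMonoid M
  open import Algebra.Properties.CommutativeMonoid.Sum M
  open import Algebra.Properties.CommutativeSemigroup commutativeSemigroup using (xy∙z≈zy∙x)
  open import Relation.Binary.Reasoning.Setoid setoid

  ∑-updateAt : ∀ {n} (t u : Fin n → Carrier) i → (∀ j → j ≢ i → t j ≈ u j) →
               ∑[ j < n ] t j ∙ u i ≈ ∑[ j < n ] u j ∙ t i
  ∑-updateAt {suc n} t u i t≈u = begin
    sum t ∙ u i                               ≈⟨ ∙-congʳ (sum-remove {i = i} t) ⟩
    (t i ∙ sum (removeAt t i)) ∙ u i          ≈⟨ ∙-congʳ (∙-congˡ (sum-cong-≋ {n} λ j → t≈u _ (Fin.punchInᵢ≢i i j))) ⟩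
    (t i ∙ sum (removeAt u i)) ∙ u i          ≈⟨ xy∙z≈zy∙x (t i) _ (u i) ⟩
    (u i ∙ sum (removeAt u i)) ∙ t i          ≈⟨ ∙-congʳ (sum-remove {i = i} u) ⟨
    sum u ∙ t i                               ∎


module FiniteFieldProperties {q : ℕ} (F : FiniteField q) where

  open FiniteField F hiding (zero)
  open import Relation.Binary.Reasoning.Setoid setoid
  open import Algebra.Properties.Semiring.Exp semiring using (_^_)
  open import Algebra.Properties.Semiring.Mult semiring using (_×_; ×1-homo-*)

  index : Carrier → Fin q
  index a = proj₁ (enum-sur a)

  enum-index : ∀ a → enum (index a) ≈ a
  enum-index a = proj₂ (enum-sur a)

  index-cong : ∀ {a b} → a ≈ b → index a ≡ index b
  index-cong {a} {b} a≈b = enum-inj _ _ (trans (enum-index a) (trans a≈b (sym (enum-index b))))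

  1<q : 1 < q
  1<q = distinct⇒1<n (index 0#) (index 1#) λ i0≡i1 →
    0≉1 (trans (sym (enum-index 0#)) (trans (reflexive (≡.cong enum i0≡i1)) (enum-index 1#)))
    where
    distinct⇒1<n : ∀ {n} (i j : Fin n) → i ≢ j → 1 < n
    distinct⇒1<n {suc zero}    Fin.zero Fin.zero i≢j = ⊥-elim (i≢j ≡.refl)
    distinct⇒1<n {suc (suc n)} _        _        _   = s≤s (s≤s z≤n)

  instance
    q-nonZero : ℕ.NonZero q
    q-nonZero = ℕ.>-nonZero (ℕ.<-trans (s≤s z≤n) 1<q)

  infix 4 _≟_
  _≟_ : Decidable _≈_
  a ≟ b with index a Fin.≟ index b
  ... | yes ia≡ib = yes (trans (sym (enum-index a)) (trans (reflexive (≡.cong enum ia≡ib)) (enum-index b)))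
  ... | no  ia≢ib = no (ia≢ib ∘ index-cong)

  *-cancelˡ : ∀ {x y z} → ¬ x ≈ 0# → x * y ≈ x * z → y ≈ z
  *-cancelˡ {x} {y} {z} x≉0 xy≈xz with inverse x x≉0
  ... | x⁻¹ , xx⁻¹≈1 = begin
    y               ≈⟨ *-identityˡ y ⟨
    1# * y          ≈⟨ *-congʳ x⁻¹x≈1 ⟨
    (x⁻¹ * x) * y   ≈⟨ *-assoc x⁻¹ x y ⟩
    x⁻¹ * (x * y)   ≈⟨ *-congˡ xy≈xz ⟩
    x⁻¹ * (x * z)   ≈⟨ *-assoc x⁻¹ x z ⟨
    (x⁻¹ * x) * z   ≈⟨ *-congʳ x⁻¹x≈1 ⟩
    1# * z          ≈⟨ *-identityˡ z ⟩
    z               ∎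
    where x⁻¹x≈1 = trans (*-comm x⁻¹ x) xx⁻¹≈1

  x*y≈0⇒y≈0 : ∀ {x y} → ¬ x ≈ 0# → x * y ≈ 0# → y ≈ 0#
  x*y≈0⇒y≈0 {x} x≉0 xy≈0 = *-cancelˡ x≉0 (trans xy≈0 (sym (zeroʳ x)))

  x^n≈0⇒x≈0 : ∀ {x} n → x ^ n ≈ 0# → x ≈ 0#
  x^n≈0⇒x≈0 {x} n xⁿ≈0 with x ≟ 0#
  ... | yes x≈0 = x≈0
  ... | no  x≉0 = ⊥-elim (xⁿ≉0 n xⁿ≈0)
    where
    xⁿ≉0 : ∀ n → ¬ x ^ n ≈ 0#
    xⁿ≉0 zero    1≈0  = 0≉1 (sym 1≈0)
    xⁿ≉0 (suc n) xⁿ⁺¹≈0 = xⁿ≉0 n (x*y≈0⇒y≈0 x≉0 xⁿ⁺¹≈0)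

  module _ {m ℓm} (M : CommutativeMonoid m ℓm) where

    private module M = CommutativeMonoid M
    open import Algebra.Properties.CommutativeMonoid.Sum M

    ∑-reindex : (σ σ⁻¹ : Carrier → Carrier) →
                (∀ {a b} → a ≈ b → σ a ≈ σ b) → (∀ {a b} → a ≈ b → σ⁻¹ a ≈ σ⁻¹ b) →
                (∀ a → σ (σ⁻¹ a) ≈ a) → (∀ a → σ⁻¹ (σ a) ≈ a) →
                (f : Carrier → M.Carrier) → (∀ {a b} → a ≈ b → f a M.≈ f b) →
                ∑[ i < q ] f (enum i) M.≈ ∑[ i < q ] f (σ (enum i))
    ∑-reindex σ σ⁻¹ σ-cong σ⁻¹-cong σσ⁻¹ σ⁻¹σ f f-cong = M.trans
      (∑-permute {q} {q} (f ∘ enum)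
        (permutation (π σ) (π σ⁻¹) (inverse-π σ σ⁻¹ σ-cong σσ⁻¹) (inverse-π σ⁻¹ σ σ⁻¹-cong σ⁻¹σ)))
      (sum-cong-≋ {q} (λ i → f-cong (enum-index (σ (enum i)))))
      where
      π : (Carrier → Carrier) → Fin q → Fin q
      π τ i = index (τ (enum i))
      inverse-π : ∀ τ τ⁻¹ → (∀ {a b} → a ≈ b → τ a ≈ τ b) → (∀ a → τ (τ⁻¹ a) ≈ a) →
                  ∀ i → π τ (π τ⁻¹ i) ≡ i
      inverse-π τ τ⁻¹ τ-cong ττ⁻¹ i = enum-inj _ _ (trans (enum-index _) (trans (τ-cong (enum-index _)) (ττ⁻¹ (enum i))))

  module +-Sum = Algebra.Properties.CommutativeMonoid.Sum +-commutativeMonoid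
  module *-Sum = Algebra.Properties.CommutativeMonoid.Sum *-commutativeMonoid

  q×1≈0 : q × 1# ≈ 0#
  q×1≈0 = identityʳ-unique (∑[ i < q ] enum i) (q × 1#) (begin
    ∑[ i < q ] enum i + q × 1#               ≈⟨ +-congˡ (+-Sum.sum-replicate q) ⟨
    ∑[ i < q ] enum i + ∑[ i < q ] 1#         ≈⟨ +-Sum.∑-distrib-+ {q} enum (λ _ → 1#) ⟨
    ∑[ i < q ] (enum i + 1#)                  ≈⟨ ∑-reindex +-commutativeMonoid (_+ 1#) (_- 1#) +-congʳ +-congʳ
                                                   (cancel 1# (-‿inverseˡ 1#)) (cancel (- 1#) (-‿inverseʳ 1#))
                                                   (λ a → a) (λ a≈b → a≈b) ⟨
    ∑[ i < q ] enum i                         ∎)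
    where
    open +-Sum using (sum-syntax)
    open import Algebra.Properties.Group +-group using (identityʳ-unique)
    cancel : ∀ c {d} → d + c ≈ 0# → ∀ a → a + d + c ≈ a
    cancel c d+c≈0 a = trans (+-assoc a _ c) (trans (+-congˡ d+c≈0) (+-identityʳ a))

  characteristic : ∀ p k → q ≡ p ^ℕ k → p × 1# ≈ 0#
  characteristic p k q≡pᵏ = x^n≈0⇒x≈0 k (begin
    (p × 1#) ^ k     ≈⟨ ×1-^ k ⟨
    (p ^ℕ k) × 1#    ≡⟨ ≡.cong (_× 1#) q≡pᵏ ⟨
    q × 1#           ≈⟨ q×1≈0 ⟩
    0#               ∎)
    where
    ×1-^ : ∀ k → (p ^ℕ k) × 1# ≈ (p × 1#) ^ k
    ×1-^ zero    = +-identityʳ 1#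
    ×1-^ (suc k) = trans (×1-homo-* p (p ^ℕ k)) (*-congˡ (×1-^ k))

  ∏-syntax : ∀ n → (Fin n → Carrier) → Carrier
  ∏-syntax n = *-Sum.sum {n}

  syntax ∏-syntax n (λ i → x) = ∏[ i < n ] x

  ∏-nonzero : ∀ n (f : Fin n → Carrier) → (∀ i → ¬ f i ≈ 0#) → ¬ ∏[ i < n ] f i ≈ 0#
  ∏-nonzero zero    f f≉0 1≈0 = 0≉1 (sym 1≈0)
  ∏-nonzero (suc n) f f≉0 ∏≈0 = ∏-nonzero n (f ∘ Fin.suc) (f≉0 ∘ Fin.suc) (x*y≈0⇒y≈0 (f≉0 Fin.zero) ∏≈0)

  nonzeroPart : Carrier → Carrier
  nonzeroPart a with a ≟ 0#
  ... | yes _ = 1#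
  ... | no  _ = a

  nonzeroPart-cong : ∀ {a a′} → a ≈ a′ → nonzeroPart a ≈ nonzeroPart a′
  nonzeroPart-cong {a} {a′} a≈a′ with a ≟ 0# | a′ ≟ 0#
  ... | yes _   | yes _    = refl
  ... | yes a≈0 | no  a′≉0 = ⊥-elim (a′≉0 (trans (sym a≈a′) a≈0))
  ... | no  a≉0 | yes a′≈0 = ⊥-elim (a≉0 (trans a≈a′ a′≈0))
  ... | no  _   | no  _    = a≈a′

  nonzeroPart-nonzero : ∀ a → ¬ nonzeroPart a ≈ 0#
  nonzeroPart-nonzero a with a ≟ 0#
  ... | yes _   = λ 1≈0 → 0≉1 (sym 1≈0)
  ... | no  a≉0 = a≉0

  module _ {b} (b≉0 : ¬ b ≈ 0#) where

    b-off-0 : Carrier → Carrier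
    b-off-0 a with a ≟ 0#
    ... | yes _ = 1#
    ... | no  _ = b

    b-off-0-zero : ∀ {a} → a ≈ 0# → b-off-0 a ≈ 1#
    b-off-0-zero {a} a≈0 with a ≟ 0#
    ... | yes _   = refl
    ... | no  a≉0 = ⊥-elim (a≉0 a≈0)

    b-off-0-nonzero : ∀ {a} → ¬ a ≈ 0# → b-off-0 a ≈ b
    b-off-0-nonzero {a} a≉0 with a ≟ 0#
    ... | yes a≈0 = ⊥-elim (a≉0 a≈0)
    ... | no  _   = refl

    nonzeroPart-* : ∀ a → nonzeroPart (b * a) ≈ b-off-0 a * nonzeroPart a
    nonzeroPart-* a with a ≟ 0# | b * a ≟ 0#
    ... | yes _   | yes _    = sym (*-identityˡ 1#)
    ... | yes a≈0 | no  ba≉0 = ⊥-elim (ba≉0 (trans (*-congˡ a≈0) (zeroʳ b)))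
    ... | no  a≉0 | yes ba≈0 = ⊥-elim (a≉0 (x*y≈0⇒y≈0 b≉0 ba≈0))
    ... | no  _   | no  _    = refl

    -- b ^ (q - 1) = 1: multiplication by b permutes the nonzero elements.
    ∏-b-off-0≈1 : ∏[ i < q ] b-off-0 (enum i) ≈ 1#
    ∏-b-off-0≈1 with inverse b b≉0
    ... | b⁻¹ , bb⁻¹≈1 = sym (*-cancelˡ (∏-nonzero q (nonzeroPart ∘ enum) (nonzeroPart-nonzero ∘ enum)) (begin
      ∏nz * 1#                                        ≈⟨ *-identityʳ ∏nz ⟩
      ∏nz                                             ≈⟨ ∑-reindex *-commutativeMonoid (b *_) (b⁻¹ *_) *-congˡ *-congˡ
                                                           (cancel bb⁻¹≈1) (cancel (trans (*-comm b⁻¹ b) bb⁻¹≈1))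
                                                           nonzeroPart nonzeroPart-cong ⟩
      ∏[ i < q ] nonzeroPart (b * enum i)             ≈⟨ *-Sum.sum-cong-≋ {q} (nonzeroPart-* ∘ enum) ⟩
      ∏[ i < q ] (b-off-0 (enum i) * nonzeroPart (enum i)) ≈⟨ *-Sum.∑-distrib-+ {q} (b-off-0 ∘ enum) (nonzeroPart ∘ enum) ⟩
      ∏[ i < q ] b-off-0 (enum i) * ∏nz               ≈⟨ *-comm _ ∏nz ⟩
      ∏nz * ∏[ i < q ] b-off-0 (enum i)               ∎))
      where
      ∏nz = ∏[ i < q ] nonzeroPart (enum i)
      cancel : ∀ {c d} → c * d ≈ 1# → ∀ a → c * (d * a) ≈ a
      cancel cd≈1 a = trans (sym (*-assoc _ _ a)) (trans (*-congʳ cd≈1) (*-identityˡ a))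

  fermat : ∀ b → b ^ q ≈ b
  fermat b with b ≟ 0#
  ... | yes b≈0 = trans (^-congˡ q b≈0) (trans (0^n≈0 q) (sym b≈0))
    where
    open import Algebra.Properties.Semiring.Exp semiring using (^-congˡ)
    0^n≈0 : ∀ n .{{_ : ℕ.NonZero n}} → 0# ^ n ≈ 0#
    0^n≈0 (suc n) = zeroˡ _
  ... | no b≉0 = begin
    b ^ q                                    ≈⟨ *-Sum.sum-replicate q ⟨
    ∏[ i < q ] b                             ≈⟨ *-identityʳ _ ⟨
    ∏[ i < q ] b * 1#                        ≈⟨ *-congˡ (b-off-0-zero b≉0 (enum-index 0#)) ⟨
    ∏[ i < q ] b * b-off-0 b≉0 (enum i₀)     ≈⟨ ∑-updateAt *-commutativeMonoid (λ _ → b) (b-off-0 b≉0 ∘ enum) i₀ b≈ ⟩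
    ∏[ i < q ] b-off-0 b≉0 (enum i) * b      ≈⟨ *-congʳ (∏-b-off-0≈1 b≉0) ⟩
    1# * b                                   ≈⟨ *-identityˡ b ⟩
    b                                        ∎
    where
    i₀ = index 0#
    b≈ : ∀ j → j ≢ i₀ → b ≈ b-off-0 b≉0 (enum j)
    b≈ j j≢i₀ = sym (b-off-0-nonzero b≉0 λ j≈0 → j≢i₀ (enum-inj j i₀ (trans j≈0 (sym (enum-index 0#)))))

module LinearAlgebra {q : ℕ} (F : FiniteField q) where

  open import Data.Product using (_×_)
  open FiniteField F hiding (zero)
  open FiniteFieldProperties F using (index; enum-index; 1<q)

  -- Pigeonhole: two of the q^N vectors of unknowns have the same image in Fin (q^M).
  nontrivial-solution : ∀ {M N} → M < N → (L : Fin M → (Fin N → Carrier) → Carrier) →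
                        (∀ e x x′ → L e (λ i → x i - x′ i) ≈ L e x - L e x′) →
                        ∃[ x ] (∃[ i ] ¬ x i ≈ 0#) × (∀ e → L e x ≈ 0#)
  nontrivial-solution {M} {N} M<N L L-linear = solution (Fin.pigeonhole (ℕ.^-monoʳ-< q 1<q M<N) image)
    where
    open import Algebra.Properties.Group +-group using (x≈y⇒x∙y⁻¹≈ε; x∙y⁻¹≈ε⇒x≈y)
    open ≡.≡-Reasoning renaming (begin_ to begin-≡_; _∎ to _∎-≡)
    vector : Fin (q ^ℕ N) → Fin N → Carrier
    vector c = enum ∘ Fin.finToFun c
    image : Fin (q ^ℕ N) → Fin (q ^ℕ M)
    image c = Fin.funToFin (λ e → index (L e (vector c)))
    funToFin-cong : ∀ {n} (f g : Fin n → Fin q) → (∀ i → f i ≡ g i) → Fin.funToFin f ≡ Fin.funToFin g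
    funToFin-cong {zero}  f g f≗g = ≡.refl
    funToFin-cong {suc n} f g f≗g =
      ≡.cong₂ Fin.combine (f≗g Fin.zero) (funToFin-cong (f ∘ Fin.suc) (g ∘ Fin.suc) (f≗g ∘ Fin.suc))
    solution : (∃[ c₁ ] ∃[ c₂ ] c₁ Fin.< c₂ × image c₁ ≡ image c₂) →
               ∃[ x ] (∃[ i ] ¬ x i ≈ 0#) × (∀ e → L e x ≈ 0#)
    solution (c₁ , c₂ , c₁<c₂ , images≡) =
      (λ i → vector c₁ i - vector c₂ i) , (i₀ , vᵢ₀≉0) , λ e → trans (L-linear e _ _) (x≈y⇒x∙y⁻¹≈ε (same-image e))
      where
      same-image : ∀ e → L e (vector c₁) ≈ L e (vector c₂)
      same-image e = trans (sym (enum-index _)) (trans (reflexive (≡.cong enum (begin-≡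
        index (L e (vector c₁))                 ≡⟨ Fin.finToFun-funToFin _ e ⟨
        Fin.finToFun (image c₁) e               ≡⟨ ≡.cong (λ c → Fin.finToFun c e) images≡ ⟩
        Fin.finToFun (image c₂) e               ≡⟨ Fin.finToFun-funToFin _ e ⟩
        index (L e (vector c₂))                 ∎-≡))) (enum-index _))
      differ : ¬ (∀ i → Fin.finToFun {q} {N} c₁ i ≡ Fin.finToFun c₂ i)
      differ same = ℕ.<⇒≢ c₁<c₂ (≡.cong Fin.toℕ (begin-≡
        c₁                                      ≡⟨ Fin.funToFin-finToFin {N} {q} c₁ ⟨
        Fin.funToFin (Fin.finToFun {q} {N} c₁)  ≡⟨ funToFin-cong _ _ same ⟩
        Fin.funToFin (Fin.finToFun {q} {N} c₂)  ≡⟨ Fin.funToFin-finToFin {N} {q} c₂ ⟩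
        c₂                                      ∎-≡))
      witness = Fin.¬∀⟶∃¬ N _ (λ i → Fin.finToFun c₁ i Fin.≟ Fin.finToFun c₂ i) differ
      i₀ : Fin N
      i₀ = proj₁ witness
      vᵢ₀≉0 : ¬ vector c₁ i₀ - vector c₂ i₀ ≈ 0#
      vᵢ₀≉0 v≈0 = proj₂ witness (enum-inj _ _ (x∙y⁻¹≈ε⇒x≈y _ _ v≈0))

p∤m! : ∀ {p} → Prime p → ∀ {m} → m < p → ¬ p ∣ m !
p∤m! {p} p-prime {zero}  _   p∣1 = ℕ.<-irrefl (≡.sym (∣1⇒≡1 p∣1)) (ℕ.nonTrivial⇒n>1 p {{prime⇒nonTrivial p-prime}})
p∤m! {p} p-prime {suc m} m<p p∣m! with euclidsLemma (suc m) (m !) p-prime p∣m!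
... | inj₁ p∣1+m = ℕ.<⇒≱ m<p (∣⇒≤ p∣1+m)
... | inj₂ p∣m!  = p∤m! p-prime (ℕ.<-trans (ℕ.n<1+n m) m<p) p∣m!

p∣pCk : ∀ {p} → Prime p → ∀ {k} → 0 < k → k < p → p ∣ p C k
p∣pCk {p} p-prime {k} 0<k k<p =
  [ id , (λ p∣k!*[p∸k]! → ⊥-elim ([ p∤m! p-prime k<p , p∤m! p-prime p∸k<p ]′ (euclidsLemma _ _ p-prime p∣k!*[p∸k]!))) ]′
  (euclidsLemma (p C k) _ p-prime (≡.subst (p ∣_) p!≡pCk*k!*[p∸k]! (p∣p! p {{prime⇒nonZero p-prime}})))
  where
  instance _ = k ℕ.!* (p ∸ k) !≢0
  p∸k<p : p ∸ k < p
  p∸k<p = ℕ.∸-monoʳ-< 0<k (ℕ.<⇒≤ k<p)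
  p!≡pCk*k!*[p∸k]! : p ! ≡ (p C k) *ℕ (k ! *ℕ (p ∸ k) !)
  p!≡pCk*k!*[p∸k]! = ≡.sym (≡.trans (≡.cong (_*ℕ (k ! *ℕ (p ∸ k) !)) (nCk≡n!/k![n-k]! (ℕ.<⇒≤ k<p)))
                                    (m/n*n≡m (k![n∸k]!∣n! (ℕ.<⇒≤ k<p))))
  p∣p! : ∀ n .{{_ : ℕ.NonZero n}} → n ∣ n !
  p∣p! (suc n) = m∣m*n (n !)

module Frobenius {c ℓ} (S : CommutativeSemiring c ℓ) where

  open CommutativeSemiring S hiding (zero)
  open import Relation.Binary.Reasoning.Setoid setoid
  open import Algebra.Properties.CommutativeSemiring.Binomial S using (theorem; binomialTerm)
  open import Algebra.Properties.Semiring.Exp semiring using (_^_; ^-congˡ; ^-assocʳ)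
  open import Algebra.Properties.Semiring.Mult semiring using (_×_; ×-congʳ; ×-homo-1; ×-assoc-*; ×1-homo-*)
  open import Algebra.Properties.Monoid.Sum +-monoid using (sum; sum-cong-≋; sum-init-last; sum-replicate-zero)

  C[p,k]×x≈0 : ∀ {p} → Prime p → p × 1# ≈ 0# → ∀ {k} x → 0 < k → k < p → (p C k) × x ≈ 0#
  C[p,k]×x≈0 {p} p-prime p×1≈0 {k} x 0<k k<p with p∣pCk p-prime 0<k k<p
  ... | divides c pCk≡c*p = begin
    (p C k) × x                  ≈⟨ ×-congʳ (p C k) (*-identityˡ x) ⟨
    (p C k) × (1# * x)           ≈⟨ ×-assoc-* (p C k) 1# x ⟨
    ((p C k) × 1#) * x           ≡⟨ ≡.cong (λ n → (n × 1#) * x) pCk≡c*p ⟩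
    ((c *ℕ p) × 1#) * x          ≈⟨ *-congʳ (×1-homo-* c p) ⟩
    ((c × 1#) * (p × 1#)) * x    ≈⟨ *-congʳ (*-congˡ p×1≈0) ⟩
    ((c × 1#) * 0#) * x          ≈⟨ *-congʳ (zeroʳ _) ⟩
    0# * x                       ≈⟨ zeroˡ x ⟩
    0#                           ∎

  ^p-homo-+ : ∀ {p} → Prime p → p × 1# ≈ 0# → ∀ x y → (x + y) ^ p ≈ x ^ p + y ^ p
  ^p-homo-+ {p@(suc (suc n))} p-prime p×1≈0 x y = begin
    (x + y) ^ p                                                            ≈⟨ theorem p x y ⟩
    T Fin.zero + sum {suc (suc n)} (T ∘ Fin.suc)                           ≈⟨ +-congˡ (sum-init-last {suc n} (T ∘ Fin.suc)) ⟩
    T Fin.zero + (sum {suc n} (T ∘ Fin.suc ∘ inject₁) + T (Fin.suc (fromℕ (suc n))))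
      ≈⟨ +-cong first (+-cong (trans (sum-cong-≋ {suc n} middle) (sum-replicate-zero (suc n))) last) ⟩
    y ^ p + (0# + x ^ p)                                                   ≈⟨ +-comm _ _ ⟩
    (0# + x ^ p) + y ^ p                                                   ≈⟨ +-congʳ (+-identityˡ _) ⟩
    x ^ p + y ^ p                                                          ∎
    where
    T = binomialTerm x y p
    first : T Fin.zero ≈ y ^ p
    first = trans (×-homo-1 _) (*-identityˡ _)
    last : T (Fin.suc (fromℕ (suc n))) ≈ x ^ p
    last rewrite Fin.toℕ-fromℕ n | nCn≡1 p | ℕ.n∸n≡0 n = trans (×-homo-1 _) (*-identityʳ _)
    middle : ∀ i → T (Fin.suc (inject₁ i)) ≈ 0#
    middle i = C[p,k]×x≈0 p-prime p×1≈0 _ (s≤s z≤n)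
      (≡.subst (_< p) (≡.cong suc (≡.sym (Fin.toℕ-inject₁ i))) (s<s (Fin.toℕ<n i)))

  ^pᵉ-homo-+ : ∀ {p} → Prime p → p × 1# ≈ 0# → ∀ e x y → (x + y) ^ (p ^ℕ e) ≈ x ^ (p ^ℕ e) + y ^ (p ^ℕ e)
  ^pᵉ-homo-+ p-prime p×1≈0 zero    x y = trans (*-identityʳ _) (+-cong (sym (*-identityʳ x)) (sym (*-identityʳ y)))
  ^pᵉ-homo-+ {p} p-prime p×1≈0 (suc e) x y = begin
    (x + y) ^ (p *ℕ p ^ℕ e)                ≈⟨ ^-assocʳ (x + y) p (p ^ℕ e) ⟨
    ((x + y) ^ p) ^ (p ^ℕ e)               ≈⟨ ^-congˡ (p ^ℕ e) (^p-homo-+ p-prime p×1≈0 x y) ⟩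
    (x ^ p + y ^ p) ^ (p ^ℕ e)             ≈⟨ ^pᵉ-homo-+ p-prime p×1≈0 e (x ^ p) (y ^ p) ⟩
    (x ^ p) ^ (p ^ℕ e) + (y ^ p) ^ (p ^ℕ e) ≈⟨ +-cong (^-assocʳ x p _) (^-assocʳ y p _) ⟩
    x ^ (p *ℕ p ^ℕ e) + y ^ (p *ℕ p ^ℕ e)  ∎

module SeriesFrobenius {q : ℕ} (F : FiniteField q) (p k : ℕ) (p-prime : Prime p) (q≡pᵏ : q ≡ p ^ℕ k) where

  open FiniteField F hiding (zero)
  open FiniteFieldProperties F using (fermat; characteristic; q-nonZero)
  open PowerSeriesRing commRing
  open Inflation commRing
  open InflationByPowers commRing q
  open import Relation.Binary.Reasoning.Setoid setoid
  private module F⟦x⟧ = CommutativeRing R⟦x⟧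
  open import Algebra.Properties.Semiring.Exp F⟦x⟧.semiring using (^-congˡ; ^-assocʳ)
  open import Algebra.Properties.CommutativeSemiring.Exp F⟦x⟧.commutativeSemiring using (^-distrib-*)

  ^q-homo-+ₛ : ∀ x y → (x +ₛ y) ^ₛ q ≈ₛ x ^ₛ q +ₛ y ^ₛ q
  ^q-homo-+ₛ x y rewrite q≡pᵏ = Frobenius.^pᵉ-homo-+ F⟦x⟧.commutativeSemiring p-prime p×1ₛ≈0ₛ k x y
    where
    p×1ₛ≈0ₛ : p ×ₛ 1ₛ ≈ₛ 0ₛ
    p×1ₛ≈0ₛ zero    = trans (×ₛ1ₛ≈C p zero) (characteristic p k q≡pᵏ)
    p×1ₛ≈0ₛ (suc i) = ×ₛ1ₛ≈C p (suc i)

  C-coeff-pos : ∀ a {n} → 0 < n → C a n ≈ 0#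
  C-coeff-pos a {suc _} _ = refl

  ^q-unfold : ∀ z → z ^ₛ q ≈ₛ C (z 0) +ₛ X ^ₛ q *ₛ tail z ^ₛ q
  ^q-unfold z = F⟦x⟧.trans (^-congˡ q (C+X*tail z)) (F⟦x⟧.trans (^q-homo-+ₛ (C (z 0)) (X *ₛ tail z))
    (F⟦x⟧.+-cong (F⟦x⟧.trans (C-^ₛ (z 0) q) (C-cong (fermat (z 0)))) (^-distrib-* X (tail z) q)))

  ^q-coeff : ∀ K z {s} → s < q → (z ^ₛ q) (K *ℕ q +ℕ s) ≈ residueCoeff s K z
  ^q-coeff zero z {s} s<q = begin
    (z ^ₛ q) s                           ≈⟨ ^q-unfold z s ⟩
    C (z 0) s + (X ^ₛ q *ₛ tail z ^ₛ q) s ≈⟨ +-congˡ (X^r*ₛ-coeff-low q (tail z ^ₛ q) s s<q) ⟩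
    C (z 0) s + 0#                       ≈⟨ +-identityʳ _ ⟩
    C (z 0) s                            ≈⟨ constant s ⟩
    residueCoeff s 0 z                   ∎
    where
    constant : ∀ s → C (z 0) s ≈ residueCoeff s 0 z
    constant zero    = refl
    constant (suc _) = refl
  ^q-coeff (suc K) z {s} s<q = begin
    (z ^ₛ q) (q +ℕ K *ℕ q +ℕ s)                                   ≡⟨ ≡.cong (z ^ₛ q) (ℕ.+-assoc q (K *ℕ q) s) ⟩
    (z ^ₛ q) (q +ℕ (K *ℕ q +ℕ s))                                 ≈⟨ ^q-unfold z _ ⟩
    C (z 0) (q +ℕ (K *ℕ q +ℕ s)) + (X ^ₛ q *ₛ tail z ^ₛ q) (q +ℕ (K *ℕ q +ℕ s))
      ≈⟨ +-cong (C-coeff-pos (z 0) (ℕ.<-≤-trans (>-nonZero⁻¹ q) (ℕ.m≤m+n q _))) (X^r*ₛ-coeff-shift q (tail z ^ₛ q) _) ⟩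
    0# + (tail z ^ₛ q) (K *ℕ q +ℕ s)                              ≈⟨ +-identityˡ _ ⟩
    (tail z ^ₛ q) (K *ℕ q +ℕ s)                                   ≈⟨ ^q-coeff K (tail z) s<q ⟩
    residueCoeff s K (tail z)                                     ≈⟨ shift s ⟩
    residueCoeff s (suc K) z                                      ∎
    where
    shift : ∀ s → residueCoeff s K (tail z) ≈ residueCoeff s (suc K) z
    shift zero    = refl
    shift (suc _) = refl

  ^q≈∘x^q : ∀ z → z ^ₛ q ≈ₛ z ∘x^ q
  ^q≈∘x^q z = ≈ₛ-by-residues λ K s s<q → trans (^q-coeff K z s<q) (reflexive (≡.sym (∘x^-coeff z K s<q)))

  ^qʲ≈∘x^qʲ : ∀ j z → z ^ₛ (q ^ℕ j) ≈ₛ z ∘x^q^ j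
  ^qʲ≈∘x^qʲ zero    z n = begin
    (z ^ₛ 1) n              ≈⟨ F⟦x⟧.*-identityʳ z n ⟩
    z n                     ≈⟨ ∘x^-coeff-multiple z n ⟨
    (z ∘x^ 1) (n *ℕ 1)      ≡⟨ ≡.cong (z ∘x^ 1) (ℕ.*-identityʳ n) ⟩
    (z ∘x^ 1) n             ∎
  ^qʲ≈∘x^qʲ (suc j) z = F⟦x⟧.trans (F⟦x⟧.sym (^-assocʳ z q (q ^ℕ j)))
                       (F⟦x⟧.trans (^-congˡ (q ^ℕ j) (^q≈∘x^q z))
                       (F⟦x⟧.trans (^qʲ≈∘x^qʲ j (z ∘x^ q)) (∘x^-∘x^ q (q ^ℕ j) z)))
    where
    instance
      qʲ≢0   = ℕ.m^n≢0 q j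
      q¹⁺ʲ≢0 = ℕ.m^n≢0 q (suc j)

module Digits {q : ℕ} .{{_ : NonZero q}} where

  open ≡.≡-Reasoning

  foldl-value : ∀ acc w → foldl (λ acc d → acc *ℕ q +ℕ toℕ d) acc w ≡ acc *ℕ q ^ℕ length w +ℕ value q w
  foldl-value acc []      = ≡.sym (≡.trans (ℕ.+-identityʳ _) (ℕ.*-identityʳ acc))
  foldl-value acc (d ∷ w) = begin
    foldl _ (acc *ℕ q +ℕ toℕ d) w
      ≡⟨ foldl-value (acc *ℕ q +ℕ toℕ d) w ⟩
    (acc *ℕ q +ℕ toℕ d) *ℕ q ^ℕ length w +ℕ value q w
      ≡⟨ regroup acc q (toℕ d) (q ^ℕ length w) (value q w) ⟩
    acc *ℕ (q *ℕ q ^ℕ length w) +ℕ (toℕ d *ℕ q ^ℕ length w +ℕ value q w)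
      ≡⟨ ≡.cong (acc *ℕ (q *ℕ q ^ℕ length w) +ℕ_) (foldl-value (toℕ d) w) ⟨
    acc *ℕ q ^ℕ length (d ∷ w) +ℕ value q (d ∷ w) ∎
    where
    open +-*-Solver
    regroup : ∀ acc q d Q V → (acc *ℕ q +ℕ d) *ℕ Q +ℕ V ≡ acc *ℕ (q *ℕ Q) +ℕ (d *ℕ Q +ℕ V)
    regroup = solve 5 (λ acc q d Q V → (acc :* q :+ d) :* Q :+ V := acc :* (q :* Q) :+ (d :* Q :+ V)) ≡.refl

  value-++ : ∀ w u → value q (w ++ u) ≡ value q w *ℕ q ^ℕ length u +ℕ value q u
  value-++ w u = ≡.trans (foldl-++ _ 0 w u) (foldl-value (value q w) u)

  digits : ℕ → ℕ → List (Fin q)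
  digits zero    r = []
  digits (suc L) r = digits L (r / q) ++ [ fromℕ< (m%n<n r q) ]

  length-digits : ∀ L r → length (digits L r) ≡ L
  length-digits zero    r = ≡.refl
  length-digits (suc L) r =
    ≡.trans (length-++ (digits L (r / q))) (≡.trans (ℕ.+-comm _ 1) (≡.cong suc (length-digits L (r / q))))

  value-digits : ∀ L r → r < q ^ℕ L → value q (digits L r) ≡ r
  value-digits zero    zero    _         = ≡.refl
  value-digits zero    (suc r) (s≤s ())
  value-digits (suc L) r r<qᴸ⁺¹ = begin
    value q (digits L (r / q) ++ [ fromℕ< (m%n<n r q) ])
      ≡⟨ value-++ (digits L (r / q)) _ ⟩
    value q (digits L (r / q)) *ℕ (q *ℕ 1) +ℕ toℕ (fromℕ< (m%n<n r q))
      ≡⟨ ≡.cong₂ (λ x y → x *ℕ (q *ℕ 1) +ℕ y) (value-digits L (r / q) r/q<qᴸ) (Fin.toℕ-fromℕ< (m%n<n r q)) ⟩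
    r / q *ℕ (q *ℕ 1) +ℕ r % q
      ≡⟨ ≡.cong (λ x → r / q *ℕ x +ℕ r % q) (ℕ.*-identityʳ q) ⟩
    r / q *ℕ q +ℕ r % q
      ≡⟨ n≡[n/r]*r+n%r r ⟨
    r ∎
    where
    r/q<qᴸ : r / q < q ^ℕ L
    r/q<qᴸ = m<n*o⇒m/o<n (≡.subst (r <_) (ℕ.*-comm q (q ^ℕ L)) r<qᴸ⁺¹)

  n<qⁿ : 1 < q → ∀ n → n < q ^ℕ n
  n<qⁿ 1<q zero    = s≤s z≤n
  n<qⁿ 1<q (suc n) = ℕ.≤-trans (ℕ.+-mono-≤ (ℕ.m^n>0 q n) (n<qⁿ 1<q n))
    (ℕ.≤-trans (ℕ.≤-reflexive (≡.cong (q ^ℕ n +ℕ_) (≡.sym (ℕ.+-identityʳ _)))) (ℕ.*-monoˡ-≤ (q ^ℕ n) 1<q))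

module _ {q k : ℕ} .{{_ : NonZero q}} {O : Set} (M : DFAO q k O) where

  open Digits {q}

  endState : ℕ → ℕ → Fin k
  endState L r = δ* M (q₀ M) (reverse (digits L r))

  ReverseGenerates-split : ∀ {a} → ReverseGenerates M a → 1 < q → ∀ L r K → r < q ^ℕ L →
                           a (K *ℕ q ^ℕ L +ℕ r) ≡ τ M (δ* M (endState L r) (reverse (digits K K)))
  ReverseGenerates-split {a} generates 1<q L r K r<qᴸ = begin
    a (K *ℕ q ^ℕ L +ℕ r)
      ≡⟨ generates _ w value-w ⟨
    τ M (δ* M (q₀ M) (reverse w))
      ≡⟨ ≡.cong (τ M ∘ δ* M (q₀ M)) (reverse-++ (digits K K) (digits L r)) ⟩
    τ M (δ* M (q₀ M) (reverse (digits L r) ++ reverse (digits K K)))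
      ≡⟨ ≡.cong (τ M) (foldl-++ (δ M) (q₀ M) (reverse (digits L r)) _) ⟩
    τ M (δ* M (endState L r) (reverse (digits K K))) ∎
    where
    open ≡.≡-Reasoning
    w = digits K K ++ digits L r
    value-w : value q w ≡ K *ℕ q ^ℕ L +ℕ r
    value-w = begin
      value q w                                               ≡⟨ value-++ (digits K K) (digits L r) ⟩
      value q (digits K K) *ℕ q ^ℕ length (digits L r) +ℕ value q (digits L r)
        ≡⟨ ≡.cong₂ (λ x y → x *ℕ q ^ℕ y +ℕ value q (digits L r)) (value-digits K K (n<qⁿ 1<q K)) (length-digits L r) ⟩
      K *ℕ q ^ℕ L +ℕ value q (digits L r)                     ≡⟨ ≡.cong (K *ℕ q ^ℕ L +ℕ_) (value-digits L r r<qᴸ) ⟩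
      K *ℕ q ^ℕ L +ℕ r                                        ∎

module KernelDecomposition {q : ℕ} (F : FiniteField q) {m : ℕ} (M : DFAO q m (FiniteField.Carrier F))
                           {a : ℕ → FiniteField.Carrier F} (generates : ReverseGenerates M a) where

  open import Data.Product using (_×_)
  open FiniteField F hiding (zero)
  open FiniteFieldProperties F using (1<q; q-nonZero)
  open FiniteSum commRing
  open PowerSeriesRing commRing
  open Inflation commRing
  open InflationByPowers commRing q
  open Digits {q}
  private module F⟦x⟧ = CommutativeRing R⟦x⟧

  -- states are indexed by t < m; any t ≥ m is sent to the initial state
  state : ℕ → Fin m
  state t with t <? m
  ... | yes t<m = fromℕ< t<m
  ... | no  _   = q₀ M

  state-toℕ : ∀ s → state (toℕ s) ≡ s
  state-toℕ s with toℕ s <? m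
  ... | yes s<m = Fin.fromℕ<-toℕ s s<m
  ... | no  s≮m = ⊥-elim (s≮m (Fin.toℕ<n s))

  -- Q L t = Σ { x^r : r < q^L, reading the last L digits of r leads to state t }
  Q? : ∀ L t r → Dec (r < q ^ℕ L × toℕ (endState M L r) ≡ t)
  Q? L t r = r <? q ^ℕ L ×-dec toℕ (endState M L r) ℕ.≟ t

  Q : ℕ → ℕ → PowerSeries
  Q L t r = 𝟙 (Q? L t r)

  b : ℕ → PowerSeries
  b t K = τ M (δ* M (state t) (reverse (digits K K)))

  Q-high : ∀ L t r → q ^ℕ L ≤ r → Q L t r ≈ 0#
  Q-high L t r qᴸ≤r = 𝟙-no (Q? L t r) (λ (r<qᴸ , _) → ℕ.<⇒≱ r<qᴸ qᴸ≤r)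

  Q-other : ∀ L t r → toℕ (endState M L r) ≢ t → Q L t r ≈ 0#
  Q-other L t r ≢t = 𝟙-no (Q? L t r) (λ (_ , ≡t) → ≢t ≡t)

  Q-endState : ∀ L r → r < q ^ℕ L → Q L (toℕ (endState M L r)) r ≈ 1#
  Q-endState L r r<qᴸ = 𝟙-yes (Q? L _ r) (r<qᴸ , ≡.refl)

  decomposition : ∀ L → a ≈ₛ ∑ₛ[ t < m ] (Q L t *ₛ (b t ∘x^q^ L))
  decomposition L = ≈ₛ-by-residues λ K ρ ρ<qᴸ → let t₀ = toℕ (endState M L ρ) in begin
    a (K *ℕ q ^ℕ L +ℕ ρ)
      ≡⟨ ReverseGenerates-split M generates 1<q L ρ K ρ<qᴸ ⟩
    τ M (δ* M (endState M L ρ) (reverse (digits K K)))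
      ≡⟨ ≡.cong (λ s → τ M (δ* M s (reverse (digits K K)))) (state-toℕ (endState M L ρ)) ⟨
    b t₀ K
      ≈⟨ trans (*-congʳ (Q-endState L ρ ρ<qᴸ)) (*-identityˡ _) ⟨
    Q L t₀ ρ * b t₀ K
      ≈⟨ ∑-single m t₀ _ (Fin.toℕ<n _) (λ t _ t≢t₀ → trans (*-congʳ (Q-other L t ρ (t≢t₀ ∘ ≡.sym))) (zeroˡ _)) ⟨
    ∑[ t < m ] (Q L t ρ * b t K)
      ≈⟨ ∑-cong m (λ t → *ₛ-coeff-constant (section (q ^ℕ L) ρ (Q L t)) (b t) K (λ i i>0 → Q-high L t _ (high ρ i i>0))) ⟨
    ∑[ t < m ] (section (q ^ℕ L) ρ (Q L t) *ₛ b t) K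
      ≈⟨ ∑-cong m (λ t → *ₛ-∘x^-coeff (Q L t) (b t) K ρ<qᴸ) ⟨
    ∑[ t < m ] (Q L t *ₛ (b t ∘x^q^ L)) (K *ℕ q ^ℕ L +ℕ ρ)
      ≈⟨ ∑ₛ-coeff m _ _ ⟨
    (∑ₛ[ t < m ] (Q L t *ₛ (b t ∘x^q^ L))) (K *ℕ q ^ℕ L +ℕ ρ) ∎
    where
    instance qᴸ≢0 = ℕ.m^n≢0 q L
    open import Relation.Binary.Reasoning.Setoid setoid
    high : ∀ ρ i → 0 < i → q ^ℕ L ≤ i *ℕ q ^ℕ L +ℕ ρ
    high ρ (suc i) _ = ℕ.≤-trans (ℕ.m≤m+n (q ^ℕ L) (i *ℕ q ^ℕ L)) (ℕ.m≤m+n _ ρ)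

  P : ℕ → ℕ → PowerSeries
  P j t = Q (m ∸ j) t ∘x^q^ j

  Z : ℕ → PowerSeries
  Z t = b t ∘x^q^ m

  P-degree : ∀ j t → j ≤ m → ∀ n → q ^ℕ m ≤ n → P j t n ≈ 0#
  P-degree j t j≤m n qᵐ≤n = ∘x^-degree {{ℕ.m^n≢0 q j}} (Q (m ∸ j) t) (q ^ℕ (m ∸ j)) (Q-high (m ∸ j) t) n
    (≡.subst (_≤ n) (≡.sym (qᵐ⁻ʲ*qʲ≡qᵐ j≤m)) qᵐ≤n)
    where
    qᵐ⁻ʲ*qʲ≡qᵐ : j ≤ m → q ^ℕ (m ∸ j) *ℕ q ^ℕ j ≡ q ^ℕ m
    qᵐ⁻ʲ*qʲ≡qᵐ j≤m = ≡.trans (≡.sym (ℕ.^-distribˡ-+-* q (m ∸ j) j)) (≡.cong (q ^ℕ_) (ℕ.m∸n+n≡m j≤m))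

  inflated-decomposition : ∀ j → j ≤ m → a ∘x^q^ j ≈ₛ ∑ₛ[ t < m ] (P j t *ₛ Z t)
  inflated-decomposition j j≤m = begin
    a ∘x^q^ j
      ≈⟨ ∘x^-cong (decomposition (m ∸ j)) ⟩
    (∑ₛ[ t < m ] (Q (m ∸ j) t *ₛ (b t ∘x^q^ (m ∸ j)))) ∘x^q^ j
      ≈⟨ ∘x^-∑ₛ m _ ⟩
    ∑ₛ[ t < m ] ((Q (m ∸ j) t *ₛ (b t ∘x^q^ (m ∸ j))) ∘x^q^ j)
      ≈⟨ FS.∑-cong m (λ t → ∘x^-*ₛ (Q (m ∸ j) t) _) ⟩
    ∑ₛ[ t < m ] (P j t *ₛ ((b t ∘x^q^ (m ∸ j)) ∘x^q^ j))
      ≈⟨ FS.∑-cong m (λ t → F⟦x⟧.*-congˡ (∘x^q^-∘x^q^ (m ∸ j) j (b t))) ⟩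
    ∑ₛ[ t < m ] (P j t *ₛ (b t ∘x^q^ (m ∸ j +ℕ j)))
      ≈⟨ FS.∑-cong m (λ t → F⟦x⟧.*-congˡ (∘x^-≡ (≡.cong (q ^ℕ_) (ℕ.m∸n+n≡m j≤m)) (b t))) ⟩
    ∑ₛ[ t < m ] (P j t *ₛ Z t) ∎
    where
    instance
      qʲ≢0   = ℕ.m^n≢0 q j
      qᵐ⁻ʲ⁺ʲ≢0 = ℕ.m^n≢0 q (m ∸ j +ℕ j)
      qᵐ≢0   = ℕ.m^n≢0 q m
    module FS = FiniteSum R⟦x⟧
    open import Relation.Binary.Reasoning.Setoid F⟦x⟧.setoid

  kernel-relation : ∀ (c : ℕ → PowerSeries) → (∀ t → t < m → ∑ₛ[ j < suc m ] (c j *ₛ P j t) ≈ₛ 0ₛ) →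
                    ∑ₛ[ j < suc m ] (c j *ₛ (a ∘x^q^ j)) ≈ₛ 0ₛ
  kernel-relation c annihilates = begin
    ∑ₛ[ j < suc m ] (c j *ₛ (a ∘x^q^ j))
      ≈⟨ FS.∑-cong< (suc m) (λ j j≤m → F⟦x⟧.*-congˡ (inflated-decomposition j (ℕ.≤-pred j≤m))) ⟩
    ∑ₛ[ j < suc m ] (c j *ₛ ∑ₛ[ t < m ] (P j t *ₛ Z t))
      ≈⟨ FS.∑-cong (suc m) (λ j → FS.*-distribˡ-∑ m (c j) (λ t → P j t *ₛ Z t)) ⟩
    ∑ₛ[ j < suc m ] ∑ₛ[ t < m ] (c j *ₛ (P j t *ₛ Z t))
      ≈⟨ FS.∑-comm (suc m) m _ ⟩
    ∑ₛ[ t < m ] ∑ₛ[ j < suc m ] (c j *ₛ (P j t *ₛ Z t))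
      ≈⟨ FS.∑-cong m (λ t → FS.∑-cong (suc m) (λ j → F⟦x⟧.sym (F⟦x⟧.*-assoc (c j) (P j t) (Z t)))) ⟩
    ∑ₛ[ t < m ] ∑ₛ[ j < suc m ] (c j *ₛ P j t *ₛ Z t)
      ≈⟨ FS.∑-cong m (λ t → F⟦x⟧.sym (FS.*-distribʳ-∑ (suc m) (Z t) (λ j → c j *ₛ P j t))) ⟩
    ∑ₛ[ t < m ] (∑ₛ[ j < suc m ] (c j *ₛ P j t) *ₛ Z t)
      ≈⟨ FS.∑-zero m (λ t t<m → F⟦x⟧.trans (F⟦x⟧.*-congʳ {Z t} (annihilates t t<m)) (F⟦x⟧.zeroˡ (Z t))) ⟩
    0ₛ ∎
    where
    module FS = FiniteSum R⟦x⟧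
    open import Relation.Binary.Reasoning.Setoid F⟦x⟧.setoid

module Relations {q : ℕ} (F : FiniteField q) {m : ℕ} (M : DFAO q m (FiniteField.Carrier F))
                 {a : ℕ → FiniteField.Carrier F} (generates : ReverseGenerates M a) where

  open import Data.Product using (_×_)
  open FiniteField F hiding (zero)
  open FiniteFieldProperties F using (_≟_; q-nonZero)
  open LinearAlgebra F using (nontrivial-solution)
  open FiniteSum commRing
  open PowerSeriesRing commRing
  open Inflation commRing
  open InflationByPowers commRing q
  open KernelDecomposition F M generates
  private module F⟦x⟧ = CommutativeRing R⟦x⟧
  open import Algebra.Properties.Ring F⟦x⟧.ring using ([y-z]x≈yx-zx)

  -- chosen so that the (m + 1)(D + 1) coefficients of c_0, …, c_m outnumber the m (D + q^m)
  -- coefficients of the polynomials Σ_j c_j P j t, t < m, that are required to vanish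
  D : ℕ
  D = m *ℕ q ^ℕ m

  record Relation (L : ℕ) : Set where
    field
      L≤m      : L ≤ m
      coeff    : ℕ → PowerSeries
      degree   : ∀ j i → D < i → coeff j i ≈ 0#
      relation : ∑ₛ[ j < suc L ] (coeff j *ₛ (a ∘x^q^ j)) ≈ₛ 0ₛ

  open Relation

  Nontrivial : ∀ {L} → Relation L → Set
  Nontrivial {L} R = ∃[ j ] ∃[ i ] j ≤ L × ¬ coeff R j i ≈ 0#

  private
    unknowns equations : ℕ
    unknowns  = suc m *ℕ suc D
    equations = m *ℕ (D +ℕ q ^ℕ m)

    equations<unknowns : equations < unknowns
    equations<unknowns = ≡.subst (equations <_) (≡.sym (unknowns≡ m (q ^ℕ m))) (ℕ.m<m+n equations (s≤s z≤n))
      where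
      open +-*-Solver
      unknowns≡ : ∀ m Q → suc m *ℕ suc (m *ℕ Q) ≡ m *ℕ (m *ℕ Q +ℕ Q) +ℕ suc m
      unknowns≡ = solve 2 (λ m Q → (con 1 :+ m) :* (con 1 :+ m :* Q) := m :* (m :* Q :+ Q) :+ (con 1 :+ m)) ≡.refl

  -- c_j = Σ_{i ≤ D} x(j, i) x^i for j ≤ m, for a vector x of unknowns
  polynomials : (Fin unknowns → Carrier) → ℕ → PowerSeries
  polynomials x j i with j <? suc m | i <? suc D
  ... | yes j≤m | yes i≤D = x (combine (fromℕ< j≤m) (fromℕ< i≤D))
  ... | yes _   | no  _   = 0#
  ... | no  _   | _       = 0#

  polynomials-degree : ∀ x j i → D < i → polynomials x j i ≈ 0#
  polynomials-degree x j i D<i with j <? suc m | i <? suc D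
  ... | yes _ | yes i≤D = ⊥-elim (ℕ.<⇒≱ D<i (ℕ.≤-pred i≤D))
  ... | yes _ | no  _   = refl
  ... | no  _ | _       = refl

  polynomials-sub : ∀ x x′ j → polynomials (λ u → x u - x′ u) j ≈ₛ polynomials x j -ₛ polynomials x′ j
  polynomials-sub x x′ j i with j <? suc m | i <? suc D
  ... | yes _ | yes _ = refl
  ... | yes _ | no  _ = sym (-‿inverseʳ 0#)
  ... | no  _ | _     = sym (-‿inverseʳ 0#)

  polynomials-combine : ∀ x (j : Fin (suc m)) (i : Fin (suc D)) → polynomials x (toℕ j) (toℕ i) ≡ x (combine j i)
  polynomials-combine x j i with toℕ j <? suc m | toℕ i <? suc D
  ... | yes j<  | yes i<  = ≡.cong₂ (λ j i → x (combine j i)) (Fin.fromℕ<-toℕ j j<) (Fin.fromℕ<-toℕ i i<)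
  ... | yes _   | no  i≮ = ⊥-elim (i≮ (Fin.toℕ<n i))
  ... | no  j≮ | _       = ⊥-elim (j≮ (Fin.toℕ<n j))

  combination : (Fin unknowns → Carrier) → ℕ → PowerSeries
  combination x t = ∑ₛ[ j < suc m ] (polynomials x j *ₛ P j t)

  combination-degree : ∀ x t n → D +ℕ q ^ℕ m ≤ n → combination x t n ≈ 0#
  combination-degree x t n D+qᵐ≤n = trans (∑ₛ-coeff (suc m) _ n) (∑-zero (suc m) λ j j≤m →
    *ₛ-degree (polynomials x j) (P j t) D (q ^ℕ m) (polynomials-degree x j) (P-degree j t (ℕ.≤-pred j≤m)) n D+qᵐ≤n)

  combination-sub : ∀ x x′ t → combination (λ u → x u - x′ u) t ≈ₛ combination x t -ₛ combination x′ t
  combination-sub x x′ t = F⟦x⟧.trans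
    (FS.∑-cong (suc m) λ j → F⟦x⟧.trans (F⟦x⟧.*-congʳ {P j t} (polynomials-sub x x′ j)) ([y-z]x≈yx-zx (P j t) _ _))
    (FS.∑-distrib-sub (suc m) _ _)
    where module FS = FiniteSum R⟦x⟧

  system : Fin equations → (Fin unknowns → Carrier) → Carrier
  system e x = combination x (toℕ (proj₁ (remQuot {m} (D +ℕ q ^ℕ m) e))) (toℕ (proj₂ (remQuot {m} (D +ℕ q ^ℕ m) e)))

  exists-relation : Σ (Relation m) Nontrivial
  exists-relation = from-solution (nontrivial-solution equations<unknowns system (λ e x x′ → combination-sub x x′ _ _))
    where
    from-solution : (∃[ x ] (∃[ i ] ¬ x i ≈ 0#) × (∀ e → system e x ≈ 0#)) → Σ (Relation m) Nontrivial
    from-solution (x , (i₀ , xᵢ₀≉0) , solves) = R , nontrivial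
      where
      vanishes : ∀ t → t < m → combination x t ≈ₛ 0ₛ
      vanishes t t<m n with n <? D +ℕ q ^ℕ m
      ... | yes n< = trans (reflexive (≡.cong₂ (combination x) (≡.sym (Fin.toℕ-fromℕ< t<m)) (≡.sym (Fin.toℕ-fromℕ< n<))))
        (trans (reflexive (≡.cong (λ tn → combination x (toℕ (proj₁ tn)) (toℕ (proj₂ tn)))
                                  (≡.sym (Fin.remQuot-combine (fromℕ< t<m) (fromℕ< n<)))))
               (solves (combine (fromℕ< t<m) (fromℕ< n<))))
      ... | no  n≮ = combination-degree x t n (ℕ.≮⇒≥ n≮)
      R : Relation m
      R = record
        { L≤m      = ℕ.≤-refl
        ; coeff    = polynomials x
        ; degree   = polynomials-degree x
        ; relation = kernel-relation (polynomials x) vanishes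
        }
      nontrivial : Nontrivial R
      nontrivial = let j , i = remQuot {suc m} (suc D) i₀ in
        toℕ j , toℕ i , ℕ.≤-pred (Fin.toℕ<n j) ,
        λ cⱼᵢ≈0 → xᵢ₀≉0 (trans (reflexive (≡.sym (≡.trans (polynomials-combine x j i)
                                                           (≡.cong x (Fin.combine-remQuot {suc m} (suc D) i₀)))))
                               cⱼᵢ≈0)

  -- With c₀ = 0, comparing the coefficients of x^(K q + r) in Σ_{j ≥ 1} c_j(x) a(x^(q^j)) = 0
  -- gives a relation for a(x^(q^(j-1))) with the r-th sections of the c_j.
  shorten : ∀ {L} (R : Relation (suc L)) → (∀ i → coeff R 0 i ≈ 0#) → ∀ {r} → r < q → Relation L
  shorten {L} R c₀≈0 {r} r<q = record
    { L≤m      = ℕ.<⇒≤ (L≤m R)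
    ; coeff    = c′
    ; degree   = λ j i D<i → degree R (suc j) _ (ℕ.<-≤-trans D<i (ℕ.≤-trans (ℕ.m≤m*n i q) (ℕ.m≤m+n _ r)))
    ; relation = relation′
    }
    where
    c = coeff R
    Y : ℕ → PowerSeries
    Y j = a ∘x^q^ j
    c′ : ℕ → PowerSeries
    c′ j = section q r (c (suc j))
    relation′ : ∑ₛ[ j < suc L ] (c′ j *ₛ Y j) ≈ₛ 0ₛ
    relation′ K = begin
      (∑ₛ[ j < suc L ] (c′ j *ₛ Y j)) K
        ≈⟨ ∑ₛ-coeff (suc L) _ K ⟩
      ∑[ j < suc L ] (c′ j *ₛ Y j) K
        ≈⟨ ∑-cong (suc L) (λ j → *ₛ-∘x^-coeff (c (suc j)) (Y j) K r<q) ⟨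
      ∑[ j < suc L ] (c (suc j) *ₛ (Y j ∘x^ q)) n
        ≈⟨ ∑-cong (suc L) (λ j → *ₛ-cong {c (suc j)} (λ _ → refl) (∘x^q^-suc j a) n) ⟨
      ∑[ j < suc L ] (c (suc j) *ₛ Y (suc j)) n
        ≈⟨ +-identityˡ _ ⟨
      0# + ∑[ j < suc L ] (c (suc j) *ₛ Y (suc j)) n
        ≈⟨ +-congʳ (F⟦x⟧.trans (F⟦x⟧.*-congʳ {Y 0} c₀≈0) (F⟦x⟧.zeroˡ (Y 0)) n) ⟨
      (c 0 *ₛ Y 0) n + ∑[ j < suc L ] (c (suc j) *ₛ Y (suc j)) n ≈⟨ ∑-head (suc L) (λ j → (c j *ₛ Y j) n) ⟨
      ∑[ j < suc (suc L) ] (c j *ₛ Y j) n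
        ≈⟨ ∑ₛ-coeff (suc (suc L)) _ n ⟨
      (∑ₛ[ j < suc (suc L) ] (c j *ₛ Y j)) n
        ≈⟨ relation R n ⟩
      0# ∎
      where
      n = K *ℕ q +ℕ r
      open import Relation.Binary.Reasoning.Setoid setoid

  coeff₀≈0 : ∀ {L} (R : Relation L) → ¬ (∃[ i ] i < suc D × ¬ coeff R 0 i ≈ 0#) → ∀ i → coeff R 0 i ≈ 0#
  coeff₀≈0 R none i with i <? suc D
  ... | yes i≤D = decidable-stable (coeff R 0 i ≟ 0#) (λ c₀ᵢ≉0 → none (i , i≤D , c₀ᵢ≉0))
  ... | no  i≰D = degree R 0 i (ℕ.≮⇒≥ i≰D)

  descent : ∀ {L} (R : Relation L) → Nontrivial R → ∃[ L′ ] Σ (Relation L′) λ R′ → ∃[ i ] ¬ coeff R′ 0 i ≈ 0#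
  descent {L} R (j , i , j≤L , cⱼᵢ≉0) with ℕ.anyUpTo? (λ i → ¬? (coeff R 0 i ≟ 0#)) (suc D)
  descent {L}     R (j     , i , j≤L     , cⱼᵢ≉0) | yes (i₀ , _ , c₀ᵢ₀≉0) = L , R , i₀ , c₀ᵢ₀≉0
  descent {L}     R (zero  , i , _       , c₀ᵢ≉0) | no none = ⊥-elim (c₀ᵢ≉0 (coeff₀≈0 R none i))
  descent {suc L} R (suc j , i , s≤s j≤L , cⱼᵢ≉0) | no none =
    descent (shorten R (coeff₀≈0 R none) (m%n<n i q))
            (j , i / q , j≤L , λ c′ⱼᵢ≈0 → cⱼᵢ≉0 (trans (reflexive (≡.cong (coeff R (suc j)) (n≡[n/r]*r+n%r i))) c′ⱼᵢ≈0))

module SeriesOverFiniteField {q : ℕ} (F : FiniteField q) where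

  open import Data.Product using (_×_)
  open FiniteField F hiding (zero)
  open FiniteFieldProperties F using (_≟_; x*y≈0⇒y≈0)
  open FiniteSum commRing
  open PowerSeriesRing commRing
  open Series F using (Poly₂; NonZero₂; Annihilates; coeff; tdeg; evalAt; sumTo; powS)
  private module F⟦x⟧ = CommutativeRing R⟦x⟧

  lowest-nonzero : ∀ (f : PowerSeries) n →
                   (∃[ k ] k < n × ¬ f k ≈ 0# × (∀ i → i < k → f i ≈ 0#)) ⊎ (∀ i → i < n → f i ≈ 0#)
  lowest-nonzero f zero    = inj₂ (λ _ ())
  lowest-nonzero f (suc n) with lowest-nonzero f n
  ... | inj₁ (k , k<n , fₖ≉0 , below) = inj₁ (k , ℕ.m<n⇒m<1+n k<n , fₖ≉0 , below)
  ... | inj₂ f<n≈0 with f n ≟ 0#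
  ...   | no  fₙ≉0 = inj₁ (n , ℕ.≤-refl , fₙ≉0 , f<n≈0)
  ...   | yes fₙ≈0 = inj₂ λ i i≤n → [ f<n≈0 i , (λ { ≡.refl → fₙ≈0 }) ]′ (ℕ.m≤n⇒m<n∨m≡n (ℕ.≤-pred i≤n))

  *ₛ-zero⇒zero : ∀ f g k → f *ₛ g ≈ₛ 0ₛ → ¬ f k ≈ 0# → g ≈ₛ 0ₛ
  *ₛ-zero⇒zero f g k fg≈0 fₖ≉0 with lowest-nonzero f (suc k)
  ... | inj₂ f≤k≈0 = ⊥-elim (fₖ≉0 (f≤k≈0 k ℕ.≤-refl))
  ... | inj₁ (k₀ , _ , fₖ₀≉0 , below) = <-rec (λ n → g n ≈ 0#) λ n g<n≈0 →
    x*y≈0⇒y≈0 fₖ₀≉0 (trans (sym (*ₛ-coeff-lowest f g k₀ n below (λ j j<n → g<n≈0 j<n))) (fg≈0 (k₀ +ℕ n)))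

  sumTo≡∑< : ∀ n f → sumTo n f ≡ ∑< n f
  sumTo≡∑< zero    f = ≡.refl
  sumTo≡∑< (suc n) f = ≡.cong (_+ f n) (sumTo≡∑< n f)

  powS≈^ₛ : ∀ y j → powS y j ≈ₛ y ^ₛ j
  powS≈^ₛ y zero    zero    = refl
  powS≈^ₛ y zero    (suc n) = refl
  powS≈^ₛ y (suc j) n = trans (reflexive (sumTo≡∑< (suc n) _)) (∑-cong (suc n) (λ i → *-congˡ (powS≈^ₛ y j (n ∸ i))))

  T-poly : Poly₂
  T-poly = record { xdeg = 0 ; tdeg = 1 ; coeff = t ; x-bound = x-bound ; T-bound = T-bound }
    where
    t : ℕ → ℕ → Carrier
    t zero (suc zero) = 1#
    t _    _          = 0#
    x-bound : ∀ i e → 0 < i → t i e ≈ 0#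
    x-bound (suc _) _ _ = refl
    T-bound : ∀ i e → 1 < e → t i e ≈ 0#
    T-bound zero    (suc zero)    (s≤s ())
    T-bound zero    (suc (suc _)) _ = refl
    T-bound (suc _) _             _ = refl

  T-coeff : Poly₂ → ℕ → PowerSeries
  T-coeff f e i = coeff f i e

  evalAt≈∑ : ∀ f y → evalAt f y ≈ₛ ∑ₛ[ e < suc (tdeg f) ] (T-coeff f e *ₛ y ^ₛ e)
  evalAt≈∑ f y n = trans (reflexive (sumTo≡∑< (suc (tdeg f)) _)) (trans
    (∑-cong (suc (tdeg f)) λ e →
      trans (reflexive (sumTo≡∑< (suc n) _)) (∑-cong (suc n) λ i → *-congˡ (powS≈^ₛ y e (n ∸ i))))
    (sym (∑ₛ-coeff (suc (tdeg f)) _ n)))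

  T-poly-nonzero : NonZero₂ T-poly
  T-poly-nonzero = 0 , 1 , λ 1≈0 → 0≉1 (sym 1≈0)

  T-poly-annihilates : ∀ {y} → y ≈ₛ 0ₛ → Annihilates T-poly y
  T-poly-annihilates {y} y≈0 n =
    trans (evalAt≈∑ T-poly y n) (trans (∑ₛ-coeff 2 (λ e → T-coeff T-poly e *ₛ y ^ₛ e) n) (∑-zero 2 term))
    where
    term : ∀ e → e < 2 → (T-coeff T-poly e *ₛ y ^ₛ e) n ≈ 0#
    term zero    _ = ∑-zero (suc n) λ where
      zero    _ → zeroˡ _
      (suc _) _ → zeroˡ _
    term (suc e) _ = F⟦x⟧.trans
      (F⟦x⟧.*-congˡ {T-coeff T-poly (suc e)} (F⟦x⟧.trans (F⟦x⟧.*-congʳ {y ^ₛ e} y≈0) (F⟦x⟧.zeroˡ (y ^ₛ e))))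
      (F⟦x⟧.zeroʳ (T-coeff T-poly (suc e))) n

module AlgebraicityBounds {q : ℕ} (F : FiniteField q) (p k : ℕ) (p-prime : Prime p) (q≡pᵏ : q ≡ p ^ℕ k)
                          {m : ℕ} (M : DFAO q m (FiniteField.Carrier F))
                          {a : ℕ → FiniteField.Carrier F} (generates : ReverseGenerates M a) where

  open import Data.Product using (_×_)
  open FiniteField F hiding (zero)
  open FiniteFieldProperties F using (1<q; q-nonZero)
  open FiniteSum commRing
  open PowerSeriesRing commRing
  open InflationByPowers commRing q
  open SeriesFrobenius F p k p-prime q≡pᵏ using (^qʲ≈∘x^qʲ)
  open SeriesOverFiniteField F
  open Relations F M generates
  open Series F using (Poly₂; NonZero₂; Annihilates; xdeg; tdeg)
  private module F⟦x⟧ = CommutativeRing R⟦x⟧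
  open import Algebra.Properties.CommutativeSemigroup F⟦x⟧.*-commutativeSemigroup using (x∙yz≈y∙xz)

  T : ℕ
  T = q ^ℕ m ∸ 1

  qʲ∸1≤T : ∀ {j} → j ≤ m → q ^ℕ j ∸ 1 ≤ T
  qʲ∸1≤T j≤m = ℕ.∸-monoˡ-≤ 1 (ℕ.^-monoʳ-≤ q j≤m)

  1+[qʲ∸1]≡qʲ : ∀ j → suc (q ^ℕ j ∸ 1) ≡ q ^ℕ j
  1+[qʲ∸1]≡qʲ j = ℕ.m+[n∸m]≡n (ℕ.m^n>0 q j)

  AnnihilatingPolynomial : Set
  AnnihilatingPolynomial = Σ Poly₂ λ f → NonZero₂ f × Annihilates f a × tdeg f ≤ T × xdeg f ≤ m *ℕ q ^ℕ (m +ℕ 1)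

  -- For a relation Σ_{j ≤ L} c_j(x) a(x^(q^j)) = 0, the polynomial G(x, T) = Σ_j c_j(x) T^(q^j - 1)
  -- satisfies a G(x, a) = Σ_j c_j a^(q^j) = 0 by the Frobenius identity a^(q^j) = a(x^(q^j)).
  module Polynomial {L} (R : Relation L) where

    open Relation R

    ι : ℕ → ℕ → Carrier
    ι e j = 𝟙 (e ℕ.≟ q ^ℕ j ∸ 1)

    G-coeff : ℕ → PowerSeries
    G-coeff e = ∑ₛ[ j < suc L ] (C (ι e j) *ₛ coeff j)

    G-coeff-pointwise : ∀ e i → G-coeff e i ≈ ∑[ j < suc L ] (ι e j * coeff j i)
    G-coeff-pointwise e i = trans (∑ₛ-coeff (suc L) _ i) (∑-cong (suc L) (λ j → C-*ₛ _ (coeff j) i))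

    ι-high : ∀ {e j} → T < e → j ≤ L → ι e j ≈ 0#
    ι-high {e} T<e j≤L = 𝟙-no (e ℕ.≟ _) λ { ≡.refl → ℕ.<⇒≱ T<e (qʲ∸1≤T (ℕ.≤-trans j≤L L≤m)) }

    ι-0 : ∀ j → 0 < j → ι 0 j ≈ 0#
    ι-0 (suc j) _ = 𝟙-no (0 ℕ.≟ _) (ℕ.<⇒≢ (ℕ.m<n⇒0<n∸m (ℕ.<-≤-trans 1<q (ℕ.m≤m*n q (q ^ℕ j) {{ℕ.m^n≢0 q j}}))))

    G : Poly₂
    G = record
      { xdeg    = D
      ; tdeg    = T
      ; coeff   = λ i e → G-coeff e i
      ; x-bound = λ i e D<i → trans (G-coeff-pointwise e i)
                    (∑-zero (suc L) λ j _ → trans (*-congˡ (degree j i D<i)) (zeroʳ _))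
      ; T-bound = λ i e T<e → trans (G-coeff-pointwise e i)
                    (∑-zero (suc L) λ j j≤L → trans (*-congʳ (ι-high T<e (ℕ.≤-pred j≤L))) (zeroˡ _))
      }

    G-coeff-0 : ∀ i → G-coeff 0 i ≈ coeff 0 i
    G-coeff-0 i = trans (G-coeff-pointwise 0 i) (trans (∑-single (suc L) 0 _ (s≤s z≤n) others)
                                                       (trans (*-congʳ (𝟙-yes (0 ℕ.≟ 0) ≡.refl)) (*-identityˡ _)))
      where
      others : ∀ j → j < suc L → j ≢ 0 → ι 0 j * coeff j i ≈ 0#
      others zero    _ 0≢0 = ⊥-elim (0≢0 ≡.refl)
      others (suc j) _ _   = trans (*-congʳ (ι-0 (suc j) (s≤s z≤n))) (zeroˡ _)

    G[a] : PowerSeries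
    G[a] = ∑ₛ[ e < suc T ] (G-coeff e *ₛ a ^ₛ e)

    a*G[a]≈0 : a *ₛ G[a] ≈ₛ 0ₛ
    a*G[a]≈0 = begin
      a *ₛ ∑ₛ[ e < suc T ] (G-coeff e *ₛ a ^ₛ e)
        ≈⟨ FS.*-distribˡ-∑ (suc T) a (λ e → G-coeff e *ₛ a ^ₛ e) ⟩
      ∑ₛ[ e < suc T ] (a *ₛ (G-coeff e *ₛ a ^ₛ e))
        ≈⟨ FS.∑-cong (suc T) (λ e → x∙yz≈y∙xz a (G-coeff e) (a ^ₛ e)) ⟩
      ∑ₛ[ e < suc T ] (G-coeff e *ₛ a ^ₛ suc e)
        ≈⟨ FS.∑-cong (suc T) (λ e → FS.*-distribʳ-∑ (suc L) (a ^ₛ suc e) (λ j → C (ι e j) *ₛ coeff j)) ⟩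
      ∑ₛ[ e < suc T ] ∑ₛ[ j < suc L ] (C (ι e j) *ₛ coeff j *ₛ a ^ₛ suc e)
        ≈⟨ FS.∑-comm (suc T) (suc L) (λ e j → C (ι e j) *ₛ coeff j *ₛ a ^ₛ suc e) ⟩
      ∑ₛ[ j < suc L ] ∑ₛ[ e < suc T ] (C (ι e j) *ₛ coeff j *ₛ a ^ₛ suc e)
        ≈⟨ FS.∑-cong< (suc L) (λ j j≤L → only-qʲ∸1 j (ℕ.≤-pred j≤L)) ⟩
      ∑ₛ[ j < suc L ] (coeff j *ₛ a ^ₛ (q ^ℕ j))
        ≈⟨ FS.∑-cong (suc L) (λ j → F⟦x⟧.*-congˡ (^qʲ≈∘x^qʲ j a)) ⟩
      ∑ₛ[ j < suc L ] (coeff j *ₛ (a ∘x^q^ j))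
        ≈⟨ relation ⟩
      0ₛ ∎
      where
      module FS = FiniteSum R⟦x⟧
      open import Relation.Binary.Reasoning.Setoid F⟦x⟧.setoid
      only-qʲ∸1 : ∀ j → j ≤ L →
                  ∑ₛ[ e < suc T ] (C (ι e j) *ₛ coeff j *ₛ a ^ₛ suc e) ≈ₛ coeff j *ₛ a ^ₛ (q ^ℕ j)
      only-qʲ∸1 j j≤L =
        F⟦x⟧.trans (FS.∑-single (suc T) (q ^ℕ j ∸ 1) _ (s≤s (qʲ∸1≤T (ℕ.≤-trans j≤L L≤m))) others) at-qʲ∸1
        where
        at-qʲ∸1 : C (ι (q ^ℕ j ∸ 1) j) *ₛ coeff j *ₛ a ^ₛ suc (q ^ℕ j ∸ 1) ≈ₛ coeff j *ₛ a ^ₛ (q ^ℕ j)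
        at-qʲ∸1 = begin
          C (ι (q ^ℕ j ∸ 1) j) *ₛ coeff j *ₛ a ^ₛ suc (q ^ℕ j ∸ 1)
            ≈⟨ F⟦x⟧.*-congʳ {a ^ₛ suc (q ^ℕ j ∸ 1)} (F⟦x⟧.*-congʳ {coeff j} (C-cong (𝟙-yes (_ ℕ.≟ q ^ℕ j ∸ 1) ≡.refl))) ⟩
          1ₛ *ₛ coeff j *ₛ a ^ₛ suc (q ^ℕ j ∸ 1)
            ≈⟨ F⟦x⟧.*-congʳ {a ^ₛ suc (q ^ℕ j ∸ 1)} (F⟦x⟧.*-identityˡ (coeff j)) ⟩
          coeff j *ₛ a ^ₛ suc (q ^ℕ j ∸ 1)
            ≡⟨ ≡.cong (λ e → coeff j *ₛ a ^ₛ e) (1+[qʲ∸1]≡qʲ j) ⟩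
          coeff j *ₛ a ^ₛ (q ^ℕ j) ∎
        others : ∀ e → e < suc T → e ≢ q ^ℕ j ∸ 1 → C (ι e j) *ₛ coeff j *ₛ a ^ₛ suc e ≈ₛ 0ₛ
        others e _ e≢ = begin
          C (ι e j) *ₛ coeff j *ₛ a ^ₛ suc e
            ≈⟨ F⟦x⟧.*-congʳ {a ^ₛ suc e} (F⟦x⟧.*-congʳ {coeff j} (F⟦x⟧.trans (C-cong (𝟙-no (e ℕ.≟ _) e≢)) C-0≈0ₛ)) ⟩
          0ₛ *ₛ coeff j *ₛ a ^ₛ suc e
            ≈⟨ F⟦x⟧.*-congʳ {a ^ₛ suc e} (F⟦x⟧.zeroˡ (coeff j)) ⟩
          0ₛ *ₛ a ^ₛ suc e
            ≈⟨ F⟦x⟧.zeroˡ (a ^ₛ suc e) ⟩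
          0ₛ ∎

    G[a]≈G-coeff₀ : (∀ i → i < suc D → a i ≈ 0#) → ∀ i → i < suc D → G[a] i ≈ G-coeff 0 i
    G[a]≈G-coeff₀ a≤D≈0 i i≤D = begin
      G[a] i
        ≈⟨ ∑ₛ-coeff (suc T) (λ e → G-coeff e *ₛ a ^ₛ e) i ⟩
      ∑[ e < suc T ] (G-coeff e *ₛ a ^ₛ e) i
        ≈⟨ ∑-head T (λ e → (G-coeff e *ₛ a ^ₛ e) i) ⟩
      (G-coeff 0 *ₛ 1ₛ) i + ∑[ e < T ] (G-coeff (suc e) *ₛ a ^ₛ suc e) i
        ≈⟨ +-cong (F⟦x⟧.*-identityʳ (G-coeff 0) i) (∑-zero T λ e _ → higher e) ⟩
      G-coeff 0 i + 0#
        ≈⟨ +-identityʳ _ ⟩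
      G-coeff 0 i ∎
      where
      open import Relation.Binary.Reasoning.Setoid setoid
      higher : ∀ e → (G-coeff (suc e) *ₛ a ^ₛ suc e) i ≈ 0#
      higher e = trans (*ₛ-comm (G-coeff (suc e)) (a ^ₛ suc e) i)
                       (*ₛ-vanish-below (a ^ₛ suc e) (G-coeff (suc e)) (suc D) (*ₛ-vanish-below a (a ^ₛ e) (suc D) a≤D≈0) i i≤D)

    -- a G(x, a) = 0 in the integral domain F⟦x⟧: either G(x, a) = 0, or a = 0 and T annihilates a.
    annihilating-polynomial : ∀ i₀ → ¬ coeff 0 i₀ ≈ 0# → AnnihilatingPolynomial
    annihilating-polynomial i₀ c₀ᵢ₀≉0 with lowest-nonzero a (suc D)
    ... | inj₁ (k₀ , _ , aₖ₀≉0 , _) =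
      G , (i₀ , 0 , λ G₀ᵢ₀≈0 → c₀ᵢ₀≉0 (trans (sym (G-coeff-0 i₀)) G₀ᵢ₀≈0)) ,
      (λ n → trans (evalAt≈∑ G a n) (*ₛ-zero⇒zero a G[a] k₀ a*G[a]≈0 aₖ₀≉0 n)) ,
      ℕ.≤-refl , ℕ.*-monoʳ-≤ m (ℕ.^-monoʳ-≤ q (ℕ.m≤m+n m 1))
    ... | inj₂ a≤D≈0 =
      T-poly , T-poly-nonzero , T-poly-annihilates a≈0 , ℕ.m<n⇒0<n∸m (1<qᵐ (q₀ M)) , z≤n
      where
      i₀≤D : i₀ < suc D
      i₀≤D with i₀ <? suc D
      ... | yes i₀≤D = i₀≤D
      ... | no  i₀≰D = ⊥-elim (c₀ᵢ₀≉0 (degree 0 i₀ (ℕ.≮⇒≥ i₀≰D)))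
      a≈0 : a ≈ₛ 0ₛ
      a≈0 = *ₛ-zero⇒zero G[a] a i₀ (F⟦x⟧.trans (*ₛ-comm G[a] a) a*G[a]≈0)
              (λ G[a]ᵢ₀≈0 → c₀ᵢ₀≉0 (trans (sym (trans (G[a]≈G-coeff₀ a≤D≈0 i₀ i₀≤D) (G-coeff-0 i₀))) G[a]ᵢ₀≈0))
      1<qᵐ : ∀ {n} → Fin n → 1 < q ^ℕ n
      1<qᵐ {suc n} _ = ℕ.<-≤-trans 1<q (ℕ.m≤m*n q (q ^ℕ n) {{ℕ.m^n≢0 q n}})

  annihilating-polynomial : AnnihilatingPolynomial
  annihilating-polynomial =
    let R , nontrivial = exists-relation
        _ , R′ , i₀ , c₀ᵢ₀≉0 = descent R nontrivial
    in Polynomial.annihilating-polynomial R′ i₀ c₀ᵢ₀≉0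

open import Data.Nat using (_+_; _*_; _^_)
open import Data.Product using (_×_)

proposition2p8 :
    (q : ℕ) → IsPrimePower q → (F : FiniteField q) →
    (a : ℕ → FiniteField.Carrier F) → (m : ℕ) →
    Automatic q a → MinStates q a m →
    Series.Algebraic F a × Series.DegLe F a (q ^ m ∸ 1)
      × Series.HeightLe F a (m * q ^ (m + 1))
proposition2p8 q (p , k , p-prime , _ , q≡pᵏ) F a m _ ((M , generates) , _) =
  let f , f≉0 , f[a]≈0 , tdeg≤ , xdeg≤ = AlgebraicityBounds.annihilating-polynomial F p k p-prime q≡pᵏ M generates
  in (f , f≉0 , f[a]≈0) , (f , f≉0 , f[a]≈0 , tdeg≤) , (f , f≉0 , f[a]≈0 , xdeg≤)
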